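{- Let $a,b,c\in\mathbb R$ not all zero and $n\ge3$. The point $[a:b:c]\in\mathbb{RP}^2$ is an $n$-exception if and only if $[a:b:c]\ne[1:3:6]$ and $n_1a(n_2b+n_3c)=n_4b^2$, where $n_1=\frac{3}{\gcd(n+2,3)}$, $n_2=\gcd(n+1,n-1)$, $n_3=n-2$ if $n$ is odd and $n_3=\frac{n-2}{2}$ if $n$ is even, $n_4=\frac{n-1}{\gcd(n-1,6)}$ if $n$ is even and $n_4=\frac{2n-2}{\gcd(n-1,3)}$ if $n$ is odd.
   Context: A point $[a:b:c]$ is identified with $f=a\,m_3+b\,m_{2,1}+c\,m_{1,1,1}\in\mathbb R[x_{11},\dots,x_{1n}]$, where $m_3=\sum_j x_{1j}^3$, $m_{2,1}=\sum_{p\ne q}x_{1p}^2x_{1q}$, $m_{1,1,1}=\sum_{i<j<k}x_{1i}x_{1j}x_{1k}$. It is an $n$-exception if $\dim_{\mathbb R}\operatorname{span}_{\mathbb R}\{\partial_{11}f,\dots,\partial_{1n}f,E^{(2)}_{1,1}f\}=n$, with $\partial_{1j}=\partial/\partial x_{1j}$ and $E^{(2)}_{1,1}=\sum_j x_{1j}\partial^2/\partial x_{1j}^2$. -}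

module Defs where

open import Level using (0ℓ)
open import Algebra.Bundles using (CommutativeRing)
open import Data.Nat as ℕ using (ℕ; zero; suc; _∸_; ≢-nonZero)
open import Data.Nat.GCD using (gcd; gcd[m,n]≢0)
open import Data.Nat.DivMod using (_/_; _%_)

open import Data.Fin using (Fin; _≟_) renaming (zero to fzero; suc to fsuc)
open import Data.Product using (∃; _×_; _,_)
open import Data.Sum using (_⊎_; inj₂)
open import Data.Bool using (if_then_else_)
open import Function using (_∘_)
open import Function.Definitions using (Injective)
open import Relation.Binary.Core using (Rel)
open import Relation.Binary.Structures using (IsStrictTotalOrder)
open import Relation.Binary.PropositionalEquality using (_≡_)
open import Relation.Nullary using (¬_; does)

-- The real numbers, axiomatised as a complete ordered field
-- (every such structure is isomorphic to ℝ).

record RealField : Set₁ where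
  field
    commRing : CommutativeRing 0ℓ 0ℓ
  open CommutativeRing commRing public
  field
    1≉0       : ¬ (1# ≈ 0#)
    inverse   : ∀ x → ¬ (x ≈ 0#) → ∃ λ y → x * y ≈ 1#
    _<_       : Rel Carrier 0ℓ
    isSTO     : IsStrictTotalOrder _≈_ _<_
    +-mono-<  : ∀ {x y} z → x < y → (x + z) < (y + z)
    *-pos     : ∀ {x y} → 0# < x → 0# < y → 0# < (x * y)
  _≤_ : Rel Carrier 0ℓ
  x ≤ y = x < y ⊎ x ≈ y
  field
    complete  : (P : Carrier → Set) → (∃ λ x → P x) →
                (∃ λ b → ∀ x → P x → x ≤ b) →
                ∃ λ s → (∀ x → P x → x ≤ s) ×
                        (∀ b → (∀ x → P x → x ≤ b) → s ≤ b)

-- Polynomials in x₁₁ … x₁ₙ with real coefficients, represented by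
-- their coefficient function on exponent vectors (Fin n → ℕ).

module Poly (R : RealField) where
  open RealField R

  Exp : ℕ → Set
  Exp n = Fin n → ℕ

  Pol : ℕ → Set
  Pol n = Exp n → Carrier

  _≈ₚ_ : ∀ {n} → Pol n → Pol n → Set
  P ≈ₚ Q = ∀ e → P e ≈ Q e

  0ₚ : ∀ {n} → Pol n
  0ₚ e = 0#

  fromℕ : ℕ → Carrier
  fromℕ zero    = 0#
  fromℕ (suc k) = 1# + fromℕ k

  sumF : ∀ {k} → (Fin k → Carrier) → Carrier
  sumF {zero}  f = 0#
  sumF {suc k} f = f fzero + sumF (f ∘ fsuc)

  sumℕ : ∀ {k} → (Fin k → ℕ) → ℕ
  sumℕ {zero}  f = 0
  sumℕ {suc k} f = f fzero ℕ.+ sumℕ (f ∘ fsuc)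

  deg : ∀ {n} → Exp n → ℕ
  deg e = sumℕ e

  supp : ∀ {n} → Exp n → ℕ
  supp e = sumℕ (λ i → if does (e i ℕ.≟ 0) then 0 else 1)

  bump : ∀ {n} → Exp n → Fin n → Exp n
  bump e j i = if does (i ≟ j) then suc (e i) else e i

  -- monomial symmetric polynomials of degree 3: the coefficient of x^e is
  -- 1 iff the partition formed by the nonzero entries of e is λ
  -- (for |λ| = 3 the partition is determined by deg e = 3 and its length).
  mPart : ∀ {n} → ℕ → Pol n
  mPart ℓ e = if does (deg e ℕ.≟ 3) then (if does (supp e ℕ.≟ ℓ) then 1# else 0#) else 0#

  m₃ m₂₁ m₁₁₁ : ∀ {n} → Pol n
  m₃   = mPart 1
  m₂₁  = mPart 2
  m₁₁₁ = mPart 3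

  f : ∀ {n} → Carrier → Carrier → Carrier → Pol n
  f a b c e = a * m₃ e + b * m₂₁ e + c * m₁₁₁ e

  ∂ : ∀ {n} → Fin n → Pol n → Pol n
  ∂ j P e = fromℕ (suc (e j)) * P (bump e j)

  -- E⁽²⁾₁,₁ = Σⱼ x₁ⱼ ∂²/∂x₁ⱼ² : coefficient of x^e is Σⱼ (eⱼ+1)eⱼ·[x^(e+δⱼ)]P
  E2 : ∀ {n} → Pol n → Pol n
  E2 P e = sumF (λ j → fromℕ (suc (e j) ℕ.* e j) * P (bump e j))

  lin : ∀ {n k} → (Fin k → Carrier) → (Fin k → Pol n) → Pol n
  lin λs v e = sumF (λ i → λs i * v i e)

  LinIndep : ∀ {n k} → (Fin k → Pol n) → Set
  LinIndep v = ∀ λs → lin λs v ≈ₚ 0ₚ → ∀ i → λs i ≈ 0#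

  DimSpan : ∀ {n m} → ℕ → (Fin m → Pol n) → Set
  DimSpan {m = m} d v =
    (∃ λ (σ : Fin d → Fin m) → Injective _≡_ _≡_ σ × LinIndep (v ∘ σ)) ×
    (∀ (σ : Fin (suc d) → Fin m) → Injective _≡_ _≡_ σ → ¬ LinIndep (v ∘ σ))

  family : ∀ {n} → Pol n → Fin (suc n) → Pol n
  family P fzero    = E2 P
  family P (fsuc j) = ∂ j P

  IsException : (n : ℕ) → Carrier → Carrier → Carrier → Set
  IsException n a b c = DimSpan n (family {n} (f a b c))

  SameAs136 : Carrier → Carrier → Carrier → Set
  SameAs136 a b c = ∃ λ t → ¬ (t ≈ 0#) × a ≈ t × b ≈ t * fromℕ 3 × c ≈ t * fromℕ 6

n₁ : ℕ → ℕ
n₁ n = (3 / gcd (n ℕ.+ 2) 3) {{≢-nonZero (gcd[m,n]≢0 (n ℕ.+ 2) 3 (inj₂ λ ()))}}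

n₂ : ℕ → ℕ
n₂ n = gcd (n ℕ.+ 1) (n ∸ 1)

n₃ : ℕ → ℕ
n₃ n = if does (n % 2 ℕ.≟ 0) then (n ∸ 2) / 2 else n ∸ 2

n₄ : ℕ → ℕ
n₄ n = if does (n % 2 ℕ.≟ 0)
       then ((n ∸ 1) / gcd (n ∸ 1) 6) {{≢-nonZero (gcd[m,n]≢0 (n ∸ 1) 6 (inj₂ λ ()))}}
       else ((2 ℕ.* n ∸ 2) / gcd (n ∸ 1) 3) {{≢-nonZero (gcd[m,n]≢0 (n ∸ 1) 3 (inj₂ λ ()))}}

{-# OPTIONS --safe #-}

-- The coefficients of ∂ⱼ f and of E f = E⁽²⁾₁,₁ f vanish outside degree 2, and at x_i² and
-- x_i x_k they are read off from a, b, c. In a relation μ E f + Σⱼ ℓⱼ ∂ⱼ f = 0, comparing the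
-- coefficients at x_j² and x_k² gives α (ℓⱼ − ℓₖ) = 0, and at x_j x_l and x_k x_l gives
-- β (ℓⱼ − ℓₖ) = 0, where α = 3a − b and β = 2b − c vanish together exactly at [1:3:6].
-- Away from [1:3:6] all ℓⱼ are therefore equal to some l, and (μ, l) solves a 2×2 system of
-- determinant 2D, D = 3a(2b + (n−2)c) − 2(n−1)b². So the n + 1 polynomials are dependent iff
-- D = 0, while dropping a suitable one of them always leaves n independent ones. At [1:3:6],
-- f = t (x₁ + ⋯ + xₙ)³ and all of them are multiples of ∂₁ f. Finally,
-- k (n₁ a (n₂ b + n₃ c) − n₄ b²) = D with k = gcd(n−1, 3) for odd n and k = 2 gcd(n−1, 3) for even n.

module Submission where

open import Defs
open import Algebra.Bundles using (CommutativeRing)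
import Algebra.Solver.Ring as RingSolver
open import Algebra.Solver.Ring.AlmostCommutativeRing using (fromCommutativeRing; _-Raw-AlmostCommutative⟶_)
open import Data.Bool using (if_then_else_)
open import Data.Empty using (⊥-elim)
open import Data.Fin as Fin using (Fin; punchIn; punchOut) renaming (zero to fzero; suc to fsuc)
import Data.Fin.Properties as Finₚ
open import Data.Fin.Permutation using (permutation)
open import Data.Integer as ℤ using (ℤ; +_; -[1+_]; _⊖_)
import Data.Integer.Properties as ℤₚ
open import Data.Maybe using (Maybe; just; nothing)
open import Data.Nat as ℕ using (ℕ; zero; suc; _≤_; z≤n; s≤s; NonZero; ≢-nonZero)
import Data.Nat.Properties as ℕₚ
open import Data.Nat.Coprimality using (Coprime; coprime-divisor; gcd≡1⇒coprime)
open import Data.Nat.DivMod using (_/_; _%_; [m+kn]%n≡m%n; m/n*n≡m; m*n/n≡m)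
open import Data.Nat.Divisibility using (_∣_; ∣-antisym; ∣-trans; ∣m∣n⇒∣m+n; ∣m+n∣m⇒∣n; ∣n⇒∣m*n)
open import Data.Nat.GCD using (gcd; gcd[m,n]∣m; gcd[m,n]∣n; gcd-greatest; gcd-comm; gcd[m,n]≢0)
open import Data.Nat.Tactic.RingSolver using (solve-∀)
open import Data.Product using (∃; ∃₂; _×_; _,_; proj₁; proj₂)
open import Data.Product.Function.NonDependent.Propositional using (_×-⇔_)
open import Data.Sign as Sign using (Sign)
open import Data.Sum using (_⊎_; inj₁; inj₂)
open import Data.Vec.Functional using (insertAt; _∷_; replicate)
open import Data.Vec.Functional.Properties using (insertAt-lookup; insertAt-punchIn)
open import Function using (_∘_; id)
open import Function.Bundles using (_⇔_; mk⇔)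
open import Function.Construct.Composition using (_⇔-∘_)
open import Function.Construct.Identity using (⇔-id)
open import Function.Construct.Symmetry using (⇔-sym)
open import Function.Definitions using (Injective)
open import Relation.Binary.Definitions using (Decidable; tri<; tri≈; tri>)
open import Relation.Binary.PropositionalEquality as ≡ using (_≡_; _≢_; _≗_)
open import Relation.Binary.Structures using (IsStrictTotalOrder)
open import Relation.Nullary using (¬_; yes; no; does; contradiction)
open import Relation.Nullary.Decidable using (dec-false; _×-dec_; decidable-stable)

-- The ring solver with integer coefficients; con (+ k) denotes k · 1#, which for a numeral k
-- is definitionally Poly.fromℕ k.
module IntegerCoefficients {c ℓ} (R : CommutativeRing c ℓ) where
  open CommutativeRing R
  open import Algebra.Properties.Ring ring using (-‿distribˡ-*; -‿involutive; -0#≈0#; -‿+-comm)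
  open import Algebra.Properties.Semiring.Mult semiring using (×-homo-+; ×1-homo-*) renaming (_×_ to _·_)
  open import Relation.Binary.Reasoning.Setoid setoid
  open import Algebra.Properties.CommutativeSemigroup +-commutativeSemigroup
    using () renaming (interchange to +-interchange)
  open import Algebra.Properties.CommutativeSemigroup *-commutativeSemigroup
    using () renaming (interchange to *-interchange)

  ⟦_⟧ : ℤ → Carrier
  ⟦ + n ⟧      = n · 1#
  ⟦ -[1+ n ] ⟧ = - (suc n · 1#)

  ⟦⊖⟧ : ∀ m n → ⟦ m ⊖ n ⟧ ≈ m · 1# - n · 1#
  ⟦⊖⟧ zero    zero    = sym (trans (+-identityˡ _) -0#≈0#)
  ⟦⊖⟧ zero    (suc n) = sym (+-identityˡ _)
  ⟦⊖⟧ (suc m) zero    = sym (trans (+-congˡ -0#≈0#) (+-identityʳ _))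
  ⟦⊖⟧ (suc m) (suc n) = begin
    ⟦ suc m ⊖ suc n ⟧                         ≡⟨ ≡.cong ⟦_⟧ (ℤₚ.[1+m]⊖[1+n]≡m⊖n m n) ⟩
    ⟦ m ⊖ n ⟧                                 ≈⟨ ⟦⊖⟧ m n ⟩
    m · 1# - n · 1#                           ≈⟨ +-identityˡ _ ⟨
    0# + (m · 1# - n · 1#)                    ≈⟨ +-congʳ (-‿inverseʳ 1#) ⟨
    (1# - 1#) + (m · 1# - n · 1#)             ≈⟨ +-interchange 1# (- 1#) (m · 1#) (- (n · 1#)) ⟩
    (1# + m · 1#) + (- 1# + - (n · 1#))       ≈⟨ +-congˡ (-‿+-comm 1# _) ⟩
    suc m · 1# - suc n · 1#                   ∎

  ⟦+⟧ : ∀ i j → ⟦ i ℤ.+ j ⟧ ≈ ⟦ i ⟧ + ⟦ j ⟧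
  ⟦+⟧ (+ m)      (+ n)      = ×-homo-+ 1# m n
  ⟦+⟧ (+ m)      -[1+ n ]   = ⟦⊖⟧ m (suc n)
  ⟦+⟧ -[1+ m ]   (+ n)      = trans (⟦⊖⟧ n (suc m)) (+-comm _ _)
  ⟦+⟧ -[1+ m ]   -[1+ n ]   = begin
    - (suc (suc (m ℕ.+ n)) · 1#)              ≡⟨ ≡.cong (λ k → - (suc k · 1#)) (ℕₚ.+-suc m n) ⟨
    - ((suc m ℕ.+ suc n) · 1#)                ≈⟨ -‿cong (×-homo-+ 1# (suc m) (suc n)) ⟩
    - (suc m · 1# + suc n · 1#)               ≈⟨ -‿+-comm _ _ ⟨
    - (suc m · 1#) + - (suc n · 1#)           ∎

  ⟦-⟧ : ∀ i → ⟦ ℤ.- i ⟧ ≈ - ⟦ i ⟧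
  ⟦-⟧ (+ zero)  = sym -0#≈0#
  ⟦-⟧ (+ suc n) = refl
  ⟦-⟧ -[1+ n ]  = sym (-‿involutive _)

  ⟦_⟧ₛ : Sign → Carrier
  ⟦ Sign.+ ⟧ₛ = 1#
  ⟦ Sign.- ⟧ₛ = - 1#

  ⟦◃⟧ : ∀ s n → ⟦ s ℤ.◃ n ⟧ ≈ ⟦ s ⟧ₛ * n · 1#
  ⟦◃⟧ s       zero    = sym (zeroʳ _)
  ⟦◃⟧ Sign.+ (suc n) = sym (*-identityˡ _)
  ⟦◃⟧ Sign.- (suc n) = trans (-‿cong (sym (*-identityˡ _))) (-‿distribˡ-* 1# _)

  ⟦⟧-◃-inverse : ∀ i → ⟦ i ⟧ ≈ ⟦ ℤ.sign i ⟧ₛ * ℤ.∣ i ∣ · 1#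
  ⟦⟧-◃-inverse i =
    trans (reflexive (≡.cong ⟦_⟧ (≡.sym (ℤₚ.◃-inverse i)))) (⟦◃⟧ (ℤ.sign i) ℤ.∣ i ∣)

  ⟦*⟧ₛ : ∀ s t → ⟦ s Sign.* t ⟧ₛ ≈ ⟦ s ⟧ₛ * ⟦ t ⟧ₛ
  ⟦*⟧ₛ Sign.+ t      = sym (*-identityˡ _)
  ⟦*⟧ₛ Sign.- Sign.+ = sym (*-identityʳ _)
  ⟦*⟧ₛ Sign.- Sign.- = sym (begin
    - 1# * - 1#     ≈⟨ -‿distribˡ-* 1# (- 1#) ⟨
    - (1# * - 1#)   ≈⟨ -‿cong (*-identityˡ _) ⟩
    - - 1#          ≈⟨ -‿involutive 1# ⟩
    1#              ∎)

  ⟦*⟧ : ∀ i j → ⟦ i ℤ.* j ⟧ ≈ ⟦ i ⟧ * ⟦ j ⟧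
  ⟦*⟧ i j = begin
    ⟦ i ℤ.* j ⟧                                     ≈⟨ ⟦◃⟧ (s Sign.* t) (ℤ.∣ i ∣ ℕ.* ℤ.∣ j ∣) ⟩
    ⟦ s Sign.* t ⟧ₛ * (ℤ.∣ i ∣ ℕ.* ℤ.∣ j ∣) · 1#     ≈⟨ *-cong (⟦*⟧ₛ s t) (×1-homo-* ℤ.∣ i ∣ ℤ.∣ j ∣) ⟩
    (⟦ s ⟧ₛ * ⟦ t ⟧ₛ) * (ℤ.∣ i ∣ · 1# * ℤ.∣ j ∣ · 1#) ≈⟨ *-interchange _ _ _ _ ⟩
    (⟦ s ⟧ₛ * ℤ.∣ i ∣ · 1#) * (⟦ t ⟧ₛ * ℤ.∣ j ∣ · 1#) ≈⟨ *-cong (⟦⟧-◃-inverse i) (⟦⟧-◃-inverse j) ⟨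
    ⟦ i ⟧ * ⟦ j ⟧                                   ∎
    where s = ℤ.sign i; t = ℤ.sign j

  homomorphism : ℤ.+-*-rawRing -Raw-AlmostCommutative⟶ fromCommutativeRing R
  homomorphism = record
    { ⟦_⟧ = ⟦_⟧ ; +-homo = ⟦+⟧ ; *-homo = ⟦*⟧ ; -‿homo = ⟦-⟧
    ; 0-homo = refl ; 1-homo = +-identityʳ 1# }

  _coeff≟_ : ∀ i j → Maybe (⟦ i ⟧ ≈ ⟦ j ⟧)
  i coeff≟ j with i ℤ.≟ j
  ... | yes ≡.refl = just refl
  ... | no _       = nothing

  open RingSolver ℤ.+-*-rawRing (fromCommutativeRing R) homomorphism _coeff≟_ public
    using (solve; _:+_; _:*_; _:-_; :-_; con; _:=_)

injective⇒surjective : ∀ {k} {σ : Fin k → Fin k} → Injective _≡_ _≡_ σ → ∀ j → ∃ λ i → σ i ≡ j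
injective⇒surjective {suc k} {σ} σ-injective j with Finₚ.any? (λ i → σ i Fin.≟ j)
... | yes σi≡j = σi≡j
... | no ∄i    = contradiction (Finₚ.injective⇒≤ τ-injective) ℕₚ.1+n≰n
  where
  j≢σ : ∀ i → j ≢ σ i
  j≢σ i j≡σi = ∄i (i , ≡.sym j≡σi)
  τ : Fin (suc k) → Fin k
  τ i = punchOut (j≢σ i)
  τ-injective : Injective _≡_ _≡_ τ
  τ-injective {x} {y} = σ-injective ∘ Finₚ.punchOut-injective (j≢σ x) (j≢σ y)

third-index : ∀ {m} (j k : Fin (3 ℕ.+ m)) → ∃ λ l → l ≢ j × l ≢ k
third-index j k with j Fin.≟ k
... | yes ≡.refl = punchIn j fzero , Finₚ.punchInᵢ≢i j fzero , Finₚ.punchInᵢ≢i j fzero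
... | no j≢k    = punchIn j (punchIn k′ fzero) , Finₚ.punchInᵢ≢i j _ , l≢k
  where
  k′ = punchOut j≢k
  l≢k : punchIn j (punchIn k′ fzero) ≢ k
  l≢k l≡k = Finₚ.punchInᵢ≢i k′ fzero
    (Finₚ.punchIn-injective j _ _ (≡.trans l≡k (≡.sym (Finₚ.punchIn-punchOut j≢k))))

module OrderedField (R : RealField) where
  open RealField R
  open Poly R using (fromℕ)
  open IntegerCoefficients commRing public
  open import Algebra.Properties.Ring ring public
    using (-‿distribˡ-*; -‿involutive; -0#≈0#; x∙y⁻¹≈ε⇒x≈y; x≈y⇒x∙y⁻¹≈ε)
  open import Algebra.Properties.Semiring.Mult semiring using (×-homo-+; ×1-homo-*) renaming (_×_ to _·_)
  open import Relation.Binary.Reasoning.Setoid setoid public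
  private module < = IsStrictTotalOrder isSTO

  _≟_ : Decidable _≈_
  _≟_ = <._≟_

  0<1 : 0# < 1#
  0<1 with <.compare 0# 1#
  ... | tri< 0<1 _ _ = 0<1
  ... | tri≈ _ 0≈1 _ = ⊥-elim (1≉0 (sym 0≈1))
  ... | tri> _ _ 1<0 = proj₁ <.<-resp-≈ -1*-1≈1 (*-pos 0<-1 0<-1)
    where
    0<-1 : 0# < (- 1#)
    0<-1 = proj₁ <.<-resp-≈ (+-identityˡ _) (proj₂ <.<-resp-≈ (-‿inverseʳ 1#) (+-mono-< (- 1#) 1<0))
    -1*-1≈1 : - 1# * - 1# ≈ 1#
    -1*-1≈1 = begin
      - 1# * - 1#     ≈⟨ -‿distribˡ-* 1# (- 1#) ⟨
      - (1# * - 1#)   ≈⟨ -‿cong (*-identityˡ _) ⟩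
      - - 1#          ≈⟨ -‿involutive 1# ⟩
      1#              ∎

  0<fromℕ-suc : ∀ k → 0# < fromℕ (suc k)
  0<fromℕ-suc zero    = proj₁ <.<-resp-≈ (sym (+-identityʳ 1#)) 0<1
  0<fromℕ-suc (suc k) = <.trans (0<fromℕ-suc k) (proj₂ <.<-resp-≈ (+-identityˡ _) (+-mono-< (fromℕ (suc k)) 0<1))

  fromℕ-suc≉0 : ∀ k → ¬ fromℕ (suc k) ≈ 0#
  fromℕ-suc≉0 k k+1≈0 = <.irrefl (sym k+1≈0) (0<fromℕ-suc k)

  fromℕ≡·1 : ∀ k → fromℕ k ≡ k · 1#
  fromℕ≡·1 zero    = ≡.refl
  fromℕ≡·1 (suc k) = ≡.cong (_+_ 1#) (fromℕ≡·1 k)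

  fromℕ-+ : ∀ m n → fromℕ (m ℕ.+ n) ≈ fromℕ m + fromℕ n
  fromℕ-+ m n rewrite fromℕ≡·1 (m ℕ.+ n) | fromℕ≡·1 m | fromℕ≡·1 n = ×-homo-+ 1# m n

  fromℕ-* : ∀ m n → fromℕ (m ℕ.* n) ≈ fromℕ m * fromℕ n
  fromℕ-* m n rewrite fromℕ≡·1 (m ℕ.* n) | fromℕ≡·1 m | fromℕ≡·1 n = ×1-homo-* m n

  fromℕ-∸ : ∀ {m n} → n ℕ.≤ m → fromℕ (m ℕ.∸ n) ≈ fromℕ m - fromℕ n
  fromℕ-∸ {m} {n} n≤m = x∙y⁻¹≈ε⇒x≈y _ _ (begin
    fromℕ (m ℕ.∸ n) - (fromℕ m - fromℕ n)   ≈⟨ +-congˡ (-‿cong (+-congʳ m≈m∸n+n)) ⟩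
    fromℕ (m ℕ.∸ n) - ((fromℕ (m ℕ.∸ n) + fromℕ n) - fromℕ n)
      ≈⟨ solve 2 (λ x y → x :- ((x :+ y) :- y) := con (+ 0)) refl (fromℕ (m ℕ.∸ n)) (fromℕ n) ⟩
    0#                                        ∎)
    where
    m≈m∸n+n : fromℕ m ≈ fromℕ (m ℕ.∸ n) + fromℕ n
    m≈m∸n+n = trans (reflexive (≡.cong fromℕ (≡.sym (ℕₚ.m∸n+n≡m n≤m)))) (fromℕ-+ (m ℕ.∸ n) n)

  *-≈0ʳ : ∀ x {y} → y ≈ 0# → x * y ≈ 0#
  *-≈0ʳ x y≈0 = trans (*-congˡ y≈0) (zeroʳ x)


  +-cancelˡ-≈0 : ∀ {p q} → p ≈ 0# → p + q ≈ 0# → q ≈ 0#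
  +-cancelˡ-≈0 {p} {q} p≈0 p+q≈0 = trans (sym (+-identityˡ q)) (trans (+-congʳ (sym p≈0)) p+q≈0)

  +-cancelʳ-≈0 : ∀ {p q} → q ≈ 0# → p + q ≈ 0# → p ≈ 0#
  +-cancelʳ-≈0 {p} {q} q≈0 p+q≈0 = +-cancelˡ-≈0 q≈0 (trans (+-comm q p) p+q≈0)

  difference-≈0 : ∀ {x y} → x ≈ 0# → y ≈ 0# → x - y ≈ 0#
  difference-≈0 x≈0 y≈0 = trans (+-cong x≈0 (-‿cong y≈0)) (trans (+-congˡ -0#≈0#) (+-identityʳ 0#))

  combination-≈0 : ∀ {p q} u w → p ≈ 0# → q ≈ 0# → u * p - w * q ≈ 0#
  combination-≈0 {p} {q} u w p≈0 q≈0 = begin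
    u * p - w * q   ≈⟨ +-cong (*-congˡ p≈0) (-‿cong (*-congˡ q≈0)) ⟩
    u * 0# - w * 0# ≈⟨ solve 2 (λ u w → u :* con (+ 0) :- w :* con (+ 0) := con (+ 0)) refl u w ⟩
    0#              ∎

  *-cancelˡ-≈0 : ∀ {x y} → ¬ x ≈ 0# → x * y ≈ 0# → y ≈ 0#
  *-cancelˡ-≈0 {x} {y} x≉0 xy≈0 with inverse x x≉0
  ... | x⁻¹ , xx⁻¹≈1 = begin
    y               ≈⟨ *-identityˡ y ⟨
    1# * y          ≈⟨ *-congʳ xx⁻¹≈1 ⟨
    (x * x⁻¹) * y   ≈⟨ solve 3 (λ x x⁻¹ y → (x :* x⁻¹) :* y := x⁻¹ :* (x :* y)) refl x x⁻¹ y ⟩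
    x⁻¹ * (x * y)   ≈⟨ *-congˡ xy≈0 ⟩
    x⁻¹ * 0#        ≈⟨ zeroʳ x⁻¹ ⟩
    0#              ∎

  *-≉0 : ∀ {x y} → ¬ x ≈ 0# → ¬ y ≈ 0# → ¬ x * y ≈ 0#
  *-≉0 x≉0 y≉0 xy≈0 = y≉0 (*-cancelˡ-≈0 x≉0 xy≈0)

  *-cancelˡ-≈0-either : ∀ {x y z} → ¬ (x ≈ 0# × y ≈ 0#) → x * z ≈ 0# → y * z ≈ 0# → z ≈ 0#
  *-cancelˡ-≈0-either {z = z} ¬x≈0×y≈0 xz≈0 yz≈0 with z ≟ 0#
  ... | yes z≈0 = z≈0
  ... | no z≉0  = ⊥-elim (¬x≈0×y≈0 (*-cancelˡ-≈0 z≉0 (trans (*-comm z _) xz≈0) ,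
                                   *-cancelˡ-≈0 z≉0 (trans (*-comm z _) yz≈0)))

  det≉0⇒trivial-solution : ∀ {a₁₁ a₁₂ a₂₁ a₂₂ x y} → ¬ a₁₁ * a₂₂ - a₁₂ * a₂₁ ≈ 0# →
                           a₁₁ * x + a₁₂ * y ≈ 0# → a₂₁ * x + a₂₂ * y ≈ 0# → x ≈ 0# × y ≈ 0#
  det≉0⇒trivial-solution {a₁₁} {a₁₂} {a₂₁} {a₂₂} {x} {y} det≉0 row₁≈0 row₂≈0 =
    *-cancelˡ-≈0 det≉0 (begin
      det * x                                ≈⟨ solve 6 (λ a₁₁ a₁₂ a₂₁ a₂₂ x y →
                                                   (a₁₁ :* a₂₂ :- a₁₂ :* a₂₁) :* x
                                                := a₂₂ :* (a₁₁ :* x :+ a₁₂ :* y) :- a₁₂ :* (a₂₁ :* x :+ a₂₂ :* y))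
                                                refl a₁₁ a₁₂ a₂₁ a₂₂ x y ⟩
      a₂₂ * row₁ - a₁₂ * row₂                ≈⟨ combination-≈0 a₂₂ a₁₂ row₁≈0 row₂≈0 ⟩
      0#                                     ∎) ,
    *-cancelˡ-≈0 det≉0 (begin
      det * y                                ≈⟨ solve 6 (λ a₁₁ a₁₂ a₂₁ a₂₂ x y →
                                                   (a₁₁ :* a₂₂ :- a₁₂ :* a₂₁) :* y
                                                := a₁₁ :* (a₂₁ :* x :+ a₂₂ :* y) :- a₂₁ :* (a₁₁ :* x :+ a₁₂ :* y))
                                                refl a₁₁ a₁₂ a₂₁ a₂₂ x y ⟩
      a₁₁ * row₂ - a₂₁ * row₁                ≈⟨ combination-≈0 a₁₁ a₂₁ row₂≈0 row₁≈0 ⟩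
      0#                                     ∎)
    where
    det = a₁₁ * a₂₂ - a₁₂ * a₂₁
    row₁ = a₁₁ * x + a₁₂ * y
    row₂ = a₂₁ * x + a₂₂ * y

  det≈0⇒nontrivial-solution : ∀ a₁₁ a₁₂ a₂₁ a₂₂ → a₁₁ * a₂₂ - a₁₂ * a₂₁ ≈ 0# →
    ∃₂ λ x y → ¬ (x ≈ 0# × y ≈ 0#) × a₁₁ * x + a₁₂ * y ≈ 0# × a₂₁ * x + a₂₂ * y ≈ 0#
  det≈0⇒nontrivial-solution a₁₁ a₁₂ a₂₁ a₂₂ det≈0 with a₁₁ ≟ 0# | a₂₁ ≟ 0#
  ... | no a₁₁≉0 | _ = - a₁₂ , a₁₁ , (λ (_ , a₁₁≈0) → a₁₁≉0 a₁₁≈0) ,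
    solve 2 (λ a₁₁ a₁₂ → a₁₁ :* (:- a₁₂) :+ a₁₂ :* a₁₁ := con (+ 0)) refl a₁₁ a₁₂ ,
    trans (solve 4 (λ a₁₁ a₁₂ a₂₁ a₂₂ → a₂₁ :* (:- a₁₂) :+ a₂₂ :* a₁₁ := a₁₁ :* a₂₂ :- a₁₂ :* a₂₁)
                   refl a₁₁ a₁₂ a₂₁ a₂₂)
          det≈0
  ... | yes _ | no a₂₁≉0 = - a₂₂ , a₂₁ , (λ (_ , a₂₁≈0) → a₂₁≉0 a₂₁≈0) ,
    trans (solve 4 (λ a₁₁ a₁₂ a₂₁ a₂₂ → a₁₁ :* (:- a₂₂) :+ a₁₂ :* a₂₁ := :- (a₁₁ :* a₂₂ :- a₁₂ :* a₂₁))
                   refl a₁₁ a₁₂ a₂₁ a₂₂)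
          (trans (-‿cong det≈0) -0#≈0#) ,
    solve 2 (λ a₂₁ a₂₂ → a₂₁ :* (:- a₂₂) :+ a₂₂ :* a₂₁ := con (+ 0)) refl a₂₁ a₂₂
  ... | yes a₁₁≈0 | yes a₂₁≈0 = 1# , 0# , (λ (1≈0 , _) → 1≉0 1≈0) ,
    first-column-zero a₁₁≈0 , first-column-zero a₂₁≈0
    where
    first-column-zero : ∀ {p q} → p ≈ 0# → p * 1# + q * 0# ≈ 0#
    first-column-zero {p} {q} p≈0 = trans (+-cong (trans (*-identityʳ p) p≈0) (zeroʳ q)) (+-identityʳ 0#)

module FiniteSums (R : RealField) where
  open RealField R
  open Poly R using (sumF; fromℕ)
  open OrderedField R
  open import Algebra.Properties.CommutativeMonoid.Sum +-commutativeMonoid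
    using (sum; ∑-distrib-+; sum-remove; sum-permute; sum-cong-≋; sum-replicate)
  open import Algebra.Properties.Semiring.Sum semiring using (*-distribˡ-sum)
  open import Algebra.Properties.Semiring.Mult semiring using (×-assoc-*; ×-congʳ)

  sumF≡sum : ∀ {k} (g : Fin k → Carrier) → sumF g ≡ sum g
  sumF≡sum {zero}  g = ≡.refl
  sumF≡sum {suc k} g = ≡.cong (_+_ (g fzero)) (sumF≡sum (g ∘ fsuc))

  sumF-cong : ∀ {k} {g h : Fin k → Carrier} → (∀ i → g i ≈ h i) → sumF g ≈ sumF h
  sumF-cong {g = g} {h} g≈h rewrite sumF≡sum g | sumF≡sum h = sum-cong-≋ g≈h

  sumF-+ : ∀ {k} (g h : Fin k → Carrier) → sumF (λ i → g i + h i) ≈ sumF g + sumF h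
  sumF-+ g h rewrite sumF≡sum (λ i → g i + h i) | sumF≡sum g | sumF≡sum h = ∑-distrib-+ g h

  sumF-*ˡ : ∀ {k} x (g : Fin k → Carrier) → sumF (λ i → x * g i) ≈ x * sumF g
  sumF-*ˡ x g rewrite sumF≡sum (λ i → x * g i) | sumF≡sum g = sym (*-distribˡ-sum x g)

  sumF-*ʳ : ∀ {k} (g : Fin k → Carrier) x → sumF (λ i → g i * x) ≈ sumF g * x
  sumF-*ʳ g x = trans (sumF-cong (λ i → *-comm (g i) x)) (trans (sumF-*ˡ x g) (*-comm x (sumF g)))

  sumF-const : ∀ {k} x → sumF {k} (λ _ → x) ≈ fromℕ k * x
  sumF-const {k} x rewrite sumF≡sum {k} (λ _ → x) | fromℕ≡·1 k =
    trans (sum-replicate k) (sym (trans (×-assoc-* k 1# x) (×-congʳ k (*-identityˡ x))))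

  sumF-zero : ∀ {k} {g : Fin k → Carrier} → (∀ i → g i ≈ 0#) → sumF g ≈ 0#
  sumF-zero {k} g≈0 = trans (sumF-cong g≈0) (trans (sumF-const {k} 0#) (zeroʳ _))

  sumF-remove : ∀ {k} i (g : Fin (suc k) → Carrier) → sumF g ≈ g i + sumF (g ∘ punchIn i)
  sumF-remove i g rewrite sumF≡sum g | sumF≡sum (g ∘ punchIn i) = sum-remove g

  sumF-single : ∀ {k} i {g : Fin k → Carrier} → (∀ j → j ≢ i → g j ≈ 0#) → sumF g ≈ g i
  sumF-single {suc k} i {g} g≈0 = begin
    sumF g                       ≈⟨ sumF-remove i g ⟩
    g i + sumF (g ∘ punchIn i)   ≈⟨ +-congˡ (sumF-zero (λ j → g≈0 (punchIn i j) (Finₚ.punchInᵢ≢i i j))) ⟩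
    g i + 0#                     ≈⟨ +-identityʳ _ ⟩
    g i                          ∎

  sumF-permute : ∀ {k} (g : Fin k → Carrier) {σ : Fin k → Fin k} → Injective _≡_ _≡_ σ →
                 sumF (g ∘ σ) ≈ sumF g
  sumF-permute g {σ} σ-injective rewrite sumF≡sum (g ∘ σ) | sumF≡sum g =
    sym (sum-permute g (permutation σ σ⁻¹ (proj₂ ∘ surjection) (λ i → σ-injective (proj₂ (surjection (σ i))))))
    where
    surjection = injective⇒surjective σ-injective
    σ⁻¹ = proj₁ ∘ surjection

  δ : ∀ {k} → Fin k → Carrier → Fin k → Carrier
  δ i x j = if does (j Fin.≟ i) then x else 0#

  δ-≡ : ∀ {k} (i : Fin k) x → δ i x i ≡ x
  δ-≡ i x with i Fin.≟ i
  ... | yes _   = ≡.refl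
  ... | no i≢i = contradiction ≡.refl i≢i

  δ-≢ : ∀ {k} {i j : Fin k} x → j ≢ i → δ i x j ≡ 0#
  δ-≢ {i = i} {j} x j≢i with j Fin.≟ i
  ... | yes j≡i = contradiction j≡i j≢i
  ... | no _    = ≡.refl

  δ-elim : ∀ {k} (P : Carrier → Set) (i : Fin k) x j → (j ≡ i → P x) → (j ≢ i → P 0#) → P (δ i x j)
  δ-elim P i x j on-i off-i with j Fin.≟ i
  ... | yes j≡i = on-i j≡i
  ... | no j≢i  = off-i j≢i

  δ-≈0 : ∀ {k} {x} (i j : Fin k) → x ≈ 0# → δ i x j ≈ 0#
  δ-≈0 {x = x} i j x≈0 = δ-elim (_≈ 0#) i x j (λ _ → x≈0) (λ _ → refl)


  sumF-δ : ∀ {k} (i : Fin k) x → sumF (δ i x) ≈ x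
  sumF-δ i x = trans (sumF-single i (λ j j≢i → reflexive (δ-≢ x j≢i))) (reflexive (δ-≡ i x))

  sumF-*δ : ∀ {k} (g : Fin k → Carrier) i x → sumF (λ j → g j * δ i x j) ≈ g i * x
  sumF-*δ g i x = trans (sumF-single i (λ j j≢i → trans (*-congˡ (reflexive (δ-≢ x j≢i))) (zeroʳ _)))
                        (*-congˡ (reflexive (δ-≡ i x)))

  sumF-*δ-shift : ∀ {k} (ℓ g h : Fin k → Carrier) i x → (∀ j → g j ≈ h j + δ i x j) →
                  sumF (λ j → ℓ j * g j) ≈ sumF (λ j → ℓ j * h j) + ℓ i * x
  sumF-*δ-shift ℓ g h i x g≈h+δ = begin
    sumF (λ j → ℓ j * g j)
      ≈⟨ sumF-cong (λ j → trans (*-congˡ (g≈h+δ j)) (distribˡ (ℓ j) (h j) (δ i x j))) ⟩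
    sumF (λ j → ℓ j * h j + ℓ j * δ i x j)
      ≈⟨ sumF-+ (λ j → ℓ j * h j) (λ j → ℓ j * δ i x j) ⟩
    sumF (λ j → ℓ j * h j) + sumF (λ j → ℓ j * δ i x j)
      ≈⟨ +-congˡ (sumF-*δ ℓ i x) ⟩
    sumF (λ j → ℓ j * h j) + ℓ i * x
      ∎

module Exponents (R : RealField) where
  open Poly R using (Exp; deg; supp; bump; sumℕ)
  open import Algebra.Properties.CommutativeSemigroup ℕₚ.+-commutativeSemigroup using (x∙yz≈y∙xz)

  isZero : ℕ → ℕ
  isZero k = if does (k ℕ.≟ 0) then 1 else 0

  bump-≡ : ∀ {n} (e : Exp n) i → bump e i i ≡ suc (e i)
  bump-≡ e i with i Fin.≟ i
  ... | yes _   = ≡.refl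
  ... | no i≢i = contradiction ≡.refl i≢i

  bump-≢ : ∀ {n} (e : Exp n) {i j} → j ≢ i → bump e i j ≡ e j
  bump-≢ e {i} {j} j≢i with j Fin.≟ i
  ... | yes j≡i = contradiction j≡i j≢i
  ... | no _    = ≡.refl

  bump-cong : ∀ {n} {e e′ : Exp n} i → e ≗ e′ → bump e i ≗ bump e′ i
  bump-cong i e≗e′ j = ≡.cong (λ k → if does (j Fin.≟ i) then suc k else k) (e≗e′ j)

  sumℕ-cong : ∀ {n} {g h : Fin n → ℕ} → g ≗ h → sumℕ g ≡ sumℕ h
  sumℕ-cong {zero}  _   = ≡.refl
  sumℕ-cong {suc n} g≗h = ≡.cong₂ ℕ._+_ (g≗h fzero) (sumℕ-cong (g≗h ∘ fsuc))

  deg-cong : ∀ {n} {e e′ : Exp n} → e ≗ e′ → deg e ≡ deg e′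
  deg-cong = sumℕ-cong

  supp-cong : ∀ {n} {e e′ : Exp n} → e ≗ e′ → supp e ≡ supp e′
  supp-cong e≗e′ = sumℕ-cong (≡.cong (λ k → if does (k ℕ.≟ 0) then 0 else 1) ∘ e≗e′)

  deg-bump : ∀ {n} (e : Exp n) i → deg (bump e i) ≡ suc (deg e)
  deg-bump e fzero    = ≡.refl
  deg-bump e (fsuc i) = ≡.trans (≡.cong (e fzero ℕ.+_) (deg-bump (e ∘ fsuc) i)) (ℕₚ.+-suc _ _)

  supp-bump : ∀ {n} (e : Exp n) i → supp (bump e i) ≡ isZero (e i) ℕ.+ supp e
  supp-bump e fzero with e fzero
  ... | zero  = ≡.refl
  ... | suc _ = ≡.refl
  supp-bump e (fsuc i) =
    ≡.trans (≡.cong (s₀ ℕ.+_) (supp-bump (e ∘ fsuc) i)) (x∙yz≈y∙xz s₀ (isZero (e (fsuc i))) (supp (e ∘ fsuc)))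
    where s₀ = if does (e fzero ℕ.≟ 0) then 0 else 1

  0ᵉ : ∀ {n} → Exp n
  0ᵉ _ = 0

  deg-0ᵉ : ∀ {n} → deg (0ᵉ {n}) ≡ 0
  deg-0ᵉ {zero}  = ≡.refl
  deg-0ᵉ {suc n} = deg-0ᵉ {n}

  supp-0ᵉ : ∀ {n} → supp (0ᵉ {n}) ≡ 0
  supp-0ᵉ {zero}  = ≡.refl
  supp-0ᵉ {suc n} = supp-0ᵉ {n}

  unit : ∀ {n} → Fin n → Exp n
  unit i = bump 0ᵉ i

  mixed : ∀ {n} → Fin n → Fin n → Exp n
  mixed i k = bump (unit i) k

  square : ∀ {n} → Fin n → Exp n
  square i = mixed i i

  square-≡ : ∀ {n} (i : Fin n) → square i i ≡ 2
  square-≡ i = ≡.trans (bump-≡ (unit i) i) (≡.cong suc (bump-≡ 0ᵉ i))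

  square-≢ : ∀ {n} {i j : Fin n} → j ≢ i → square i j ≡ 0
  square-≢ {i = i} j≢i = ≡.trans (bump-≢ (unit i) j≢i) (bump-≢ 0ᵉ j≢i)

  mixed-ˡ : ∀ {n} {i k : Fin n} → i ≢ k → mixed i k i ≡ 1
  mixed-ˡ {i = i} i≢k = ≡.trans (bump-≢ (unit i) i≢k) (bump-≡ 0ᵉ i)

  mixed-ʳ : ∀ {n} {i k : Fin n} → i ≢ k → mixed i k k ≡ 1
  mixed-ʳ {i = i} {k} i≢k = ≡.trans (bump-≡ (unit i) k) (≡.cong suc (bump-≢ 0ᵉ (i≢k ∘ ≡.sym)))

  mixed-≢ : ∀ {n} {i k j : Fin n} → j ≢ i → j ≢ k → mixed i k j ≡ 0
  mixed-≢ {i = i} j≢i j≢k = ≡.trans (bump-≢ (unit i) j≢k) (bump-≢ 0ᵉ j≢i)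

  deg-mixed : ∀ {n} (i k : Fin n) → deg (mixed i k) ≡ 2
  deg-mixed {n} i k = ≡.trans (deg-bump (unit i) k) (≡.cong suc (≡.trans (deg-bump 0ᵉ i) (≡.cong suc (deg-0ᵉ {n}))))

  supp-unit : ∀ {n} (i : Fin n) → supp (unit i) ≡ 1
  supp-unit {n} i = ≡.trans (supp-bump 0ᵉ i) (≡.cong suc (supp-0ᵉ {n}))

  supp-square : ∀ {n} (i : Fin n) → supp (square i) ≡ 1
  supp-square i = ≡.trans (supp-bump (unit i) i) (≡.cong₂ ℕ._+_ (≡.cong isZero (bump-≡ 0ᵉ i)) (supp-unit i))

  supp-mixed : ∀ {n} {i k : Fin n} → i ≢ k → supp (mixed i k) ≡ 2
  supp-mixed {i = i} {k} i≢k =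
    ≡.trans (supp-bump (unit i) k) (≡.cong₂ ℕ._+_ (≡.cong isZero (bump-≢ 0ᵉ (i≢k ∘ ≡.sym))) (supp-unit i))


  deg≡0⇒≗0ᵉ : ∀ {n} (e : Exp n) → deg e ≡ 0 → e ≗ 0ᵉ
  deg≡0⇒≗0ᵉ e e≡0 fzero    = ℕₚ.m+n≡0⇒m≡0 (e fzero) e≡0
  deg≡0⇒≗0ᵉ e e≡0 (fsuc j) = deg≡0⇒≗0ᵉ (e ∘ fsuc) (ℕₚ.m+n≡0⇒n≡0 (e fzero) e≡0) j

  deg≡1⇒≗unit : ∀ {n} (e : Exp n) → deg e ≡ 1 → ∃ λ i → e ≗ unit i
  deg≡1⇒≗unit {suc n} e deg≡1 with e fzero in e₀
  ... | zero = let i , e≗ = deg≡1⇒≗unit (e ∘ fsuc) deg≡1 in fsuc i , λ { fzero → e₀ ; (fsuc j) → e≗ j }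
  ... | suc zero = fzero , λ { fzero → e₀ ; (fsuc j) → deg≡0⇒≗0ᵉ (e ∘ fsuc) (ℕₚ.suc-injective deg≡1) j }

  Degree2 : ∀ {n} → Exp n → Set
  Degree2 e = (∃ λ i → e ≗ square i) ⊎ (∃₂ λ i k → i ≢ k × e ≗ mixed i k)

  deg≡2⇒Degree2 : ∀ {n} (e : Exp n) → deg e ≡ 2 → Degree2 e
  deg≡2⇒Degree2 {suc n} e deg≡2 with e fzero in e₀
  ... | zero with deg≡2⇒Degree2 (e ∘ fsuc) deg≡2
  ...   | inj₁ (i , e≗)         = inj₁ (fsuc i , λ { fzero → e₀ ; (fsuc j) → e≗ j })
  ...   | inj₂ (i , k , i≢k , e≗) =
    inj₂ (fsuc i , fsuc k , i≢k ∘ Finₚ.suc-injective , λ { fzero → e₀ ; (fsuc j) → e≗ j })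
  deg≡2⇒Degree2 {suc n} e deg≡2 | suc zero with deg≡1⇒≗unit (e ∘ fsuc) (ℕₚ.suc-injective deg≡2)
  ...   | k , e≗ = inj₂ (fzero , fsuc k , (λ ()) , λ { fzero → e₀ ; (fsuc j) → e≗ j })
  deg≡2⇒Degree2 {suc n} e deg≡2 | suc (suc zero) =
    inj₁ (fzero , λ { fzero → e₀
                    ; (fsuc j) → deg≡0⇒≗0ᵉ (e ∘ fsuc) (ℕₚ.suc-injective (ℕₚ.suc-injective deg≡2)) j })

module Cubic (R : RealField) (a b c : RealField.Carrier R) where
  open RealField R
  open Poly R
  open OrderedField R
  open FiniteSums R
  open Exponents R

  F : ∀ {n} → Pol n
  F = f a b c

  α β : Carrier
  α = fromℕ 3 * a - b
  β = fromℕ 2 * b - c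

  -- F e reduces to cubic (deg e) (supp e).
  indicator : ℕ → ℕ → ℕ → Carrier
  indicator ℓ d s = if does (d ℕ.≟ 3) then (if does (s ℕ.≟ ℓ) then 1# else 0#) else 0#

  cubic : ℕ → ℕ → Carrier
  cubic d s = a * indicator 1 d s + b * indicator 2 d s + c * indicator 3 d s

  cubic-1 : cubic 3 1 ≈ a
  cubic-1 = trans (+-cong (+-cong (*-identityʳ a) (zeroʳ b)) (zeroʳ c)) (trans (+-identityʳ _) (+-identityʳ a))

  cubic-2 : cubic 3 2 ≈ b
  cubic-2 = trans (+-cong (+-cong (zeroʳ a) (*-identityʳ b)) (zeroʳ c)) (trans (+-identityʳ _) (+-identityˡ b))

  cubic-3 : cubic 3 3 ≈ c
  cubic-3 = trans (+-cong (+-cong (zeroʳ a) (zeroʳ b)) (*-identityʳ c)) (trans (+-congʳ (+-identityʳ 0#)) (+-identityˡ c))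

  cubic-≢3 : ∀ {d} s → d ≢ 3 → cubic d s ≈ 0#
  cubic-≢3 {d} s d≢3 rewrite dec-false (d ℕ.≟ 3) d≢3 =
    trans (+-cong (+-cong (zeroʳ a) (zeroʳ b)) (zeroʳ c)) (trans (+-identityʳ _) (+-identityʳ 0#))

  ∂F≡cubic : ∀ {n} j (e : Exp n) → ∂ j F e ≡ fromℕ (suc (e j)) * cubic (suc (deg e)) (isZero (e j) ℕ.+ supp e)
  ∂F≡cubic j e = ≡.cong₂ (λ d s → fromℕ (suc (e j)) * cubic d s) (deg-bump e j) (supp-bump e j)

  E2-term : ∀ {n} → Fin n → Exp n → Carrier
  E2-term j e = fromℕ (suc (e j) ℕ.* e j) * F (bump e j)

  E2-term≡cubic : ∀ {n} j (e : Exp n) →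
             E2-term j e ≡ fromℕ (suc (e j) ℕ.* e j) * cubic (suc (deg e)) (isZero (e j) ℕ.+ supp e)
  E2-term≡cubic j e = ≡.cong₂ (λ d s → fromℕ (suc (e j) ℕ.* e j) * cubic d s) (deg-bump e j) (supp-bump e j)

  ∂F-at : ∀ {n} j (e : Exp n) {x s} → e j ≡ x → deg e ≡ 2 → supp e ≡ s →
          ∂ j F e ≈ fromℕ (suc x) * cubic 3 (isZero x ℕ.+ s)
  ∂F-at j e ≡.refl deg≡2 ≡.refl =
    reflexive (≡.trans (∂F≡cubic j e)
      (≡.cong (λ d → fromℕ (suc (e j)) * cubic (suc d) (isZero (e j) ℕ.+ supp e)) deg≡2))

  E2-term-at : ∀ {n} j (e : Exp n) {x s} → e j ≡ x → deg e ≡ 2 → supp e ≡ s →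
               E2-term j e ≈ fromℕ (suc x ℕ.* x) * cubic 3 (isZero x ℕ.+ s)
  E2-term-at j e ≡.refl deg≡2 ≡.refl =
    reflexive (≡.trans (E2-term≡cubic j e)
      (≡.cong (λ d → fromℕ (suc (e j) ℕ.* e j) * cubic (suc d) (isZero (e j) ℕ.+ supp e)) deg≡2))

  ∂-square-≡ : ∀ {n} (i : Fin n) → ∂ i F (square i) ≈ b + α
  ∂-square-≡ i = begin
    ∂ i F (square i)      ≈⟨ ∂F-at i (square i) (square-≡ i) (deg-mixed i i) (supp-square i) ⟩
    fromℕ 3 * cubic 3 1   ≈⟨ *-congˡ cubic-1 ⟩
    fromℕ 3 * a           ≈⟨ solve 2 (λ a b → con (+ 3) :* a := b :+ (con (+ 3) :* a :- b)) refl a b ⟩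
    b + α                 ∎

  ∂-square-≢ : ∀ {n} {i j : Fin n} → j ≢ i → ∂ j F (square i) ≈ b
  ∂-square-≢ {i = i} {j} j≢i = begin
    ∂ j F (square i)      ≈⟨ ∂F-at j (square i) (square-≢ j≢i) (deg-mixed i i) (supp-square i) ⟩
    fromℕ 1 * cubic 3 2   ≈⟨ *-congˡ cubic-2 ⟩
    fromℕ 1 * b           ≈⟨ solve 1 (λ b → con (+ 1) :* b := b) refl b ⟩
    b                     ∎

  ∂-square : ∀ {n} (i j : Fin n) → ∂ j F (square i) ≈ b + δ i α j
  ∂-square i j = δ-elim (λ z → ∂ j F (square i) ≈ b + z) i α j
    (λ { ≡.refl → ∂-square-≡ i }) (λ j≢i → trans (∂-square-≢ j≢i) (sym (+-identityʳ b)))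

  ∂-mixed-ˡ : ∀ {n} {i k : Fin n} → i ≢ k → ∂ i F (mixed i k) ≈ fromℕ 2 * b
  ∂-mixed-ˡ {i = i} {k} i≢k =
    trans (∂F-at i (mixed i k) (mixed-ˡ i≢k) (deg-mixed i k) (supp-mixed i≢k)) (*-congˡ cubic-2)

  ∂-mixed-ʳ : ∀ {n} {i k : Fin n} → i ≢ k → ∂ k F (mixed i k) ≈ fromℕ 2 * b
  ∂-mixed-ʳ {i = i} {k} i≢k =
    trans (∂F-at k (mixed i k) (mixed-ʳ i≢k) (deg-mixed i k) (supp-mixed i≢k)) (*-congˡ cubic-2)

  ∂-mixed-≢ : ∀ {n} {i k j : Fin n} → i ≢ k → j ≢ i → j ≢ k → ∂ j F (mixed i k) ≈ c
  ∂-mixed-≢ {i = i} {k} {j} i≢k j≢i j≢k =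
    trans (∂F-at j (mixed i k) (mixed-≢ j≢i j≢k) (deg-mixed i k) (supp-mixed i≢k))
          (trans (*-congˡ cubic-3) (solve 1 (λ c → con (+ 1) :* c := c) refl c))

  ∂-mixed : ∀ {n} {i k : Fin n} → i ≢ k → ∀ j → ∂ j F (mixed i k) ≈ c + δ i β j + δ k β j
  ∂-mixed {i = i} {k} i≢k j = δ-elim (λ z → ∂ j F (mixed i k) ≈ c + z + δ k β j) i β j
    (λ { ≡.refl → δ-elim (λ z → ∂ j F (mixed j k) ≈ c + β + z) k β j
           (λ j≡k → contradiction j≡k i≢k)
           (λ _ → trans (∂-mixed-ˡ i≢k)
             (solve 2 (λ b c → con (+ 2) :* b := c :+ (con (+ 2) :* b :- c) :+ con (+ 0)) refl b c)) })
    (λ j≢i → δ-elim (λ z → ∂ j F (mixed i k) ≈ c + 0# + z) k β j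
           (λ { ≡.refl → trans (∂-mixed-ʳ i≢k)
             (solve 2 (λ b c → con (+ 2) :* b := c :+ con (+ 0) :+ (con (+ 2) :* b :- c)) refl b c) })
           (λ j≢k → trans (∂-mixed-≢ i≢k j≢i j≢k) (solve 1 (λ c → c := c :+ con (+ 0) :+ con (+ 0)) refl c)))

  E2-square : ∀ {n} (i : Fin n) → E2 F (square i) ≈ fromℕ 6 * a
  E2-square i = trans (sumF-cong term) (sumF-δ i (fromℕ 6 * a))
    where
    term : ∀ j → E2-term j (square i) ≈ δ i (fromℕ 6 * a) j
    term j = δ-elim (E2-term j (square i) ≈_) i (fromℕ 6 * a) j
      (λ { ≡.refl → trans (E2-term-at j (square j) (square-≡ j) (deg-mixed j j) (supp-square j)) (*-congˡ cubic-1) })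
      (λ j≢i → trans (E2-term-at j (square i) (square-≢ j≢i) (deg-mixed i i) (supp-square i)) (zeroˡ _))

  E2-mixed : ∀ {n} {i k : Fin n} → i ≢ k → E2 F (mixed i k) ≈ fromℕ 4 * b
  E2-mixed {i = i} {k} i≢k = begin
    E2 F (mixed i k)                        ≈⟨ sumF-cong term ⟩
    sumF (λ j → δ i 2b j + δ k 2b j)        ≈⟨ sumF-+ (δ i 2b) (δ k 2b) ⟩
    sumF (δ i 2b) + sumF (δ k 2b)           ≈⟨ +-cong (sumF-δ i 2b) (sumF-δ k 2b) ⟩
    fromℕ 2 * b + fromℕ 2 * b               ≈⟨ solve 1 (λ b → con (+ 2) :* b :+ con (+ 2) :* b := con (+ 4) :* b) refl b ⟩
    fromℕ 4 * b                             ∎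
    where
    2b = fromℕ 2 * b
    term : ∀ j → E2-term j (mixed i k) ≈ δ i 2b j + δ k 2b j
    term j = δ-elim (λ z → E2-term j (mixed i k) ≈ z + δ k 2b j) i 2b j
      (λ { ≡.refl → δ-elim (λ z → E2-term j (mixed j k) ≈ 2b + z) k 2b j
             (λ j≡k → contradiction j≡k i≢k)
             (λ _ → trans (E2-term-at j (mixed j k) (mixed-ˡ i≢k) (deg-mixed j k) (supp-mixed i≢k))
                          (trans (*-congˡ cubic-2) (sym (+-identityʳ _)))) })
      (λ j≢i → δ-elim (λ z → E2-term j (mixed i k) ≈ 0# + z) k 2b j
             (λ { ≡.refl → trans (E2-term-at j (mixed i j) (mixed-ʳ i≢k) (deg-mixed i j) (supp-mixed i≢k))
                                 (trans (*-congˡ cubic-2) (sym (+-identityˡ _))) })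
             (λ j≢k → trans (E2-term-at j (mixed i k) (mixed-≢ j≢i j≢k) (deg-mixed i k) (supp-mixed i≢k))
                            (trans (zeroˡ _) (sym (+-identityˡ _)))))

  ∂-vanishes : ∀ {n} j {e : Exp n} → deg e ≢ 2 → ∂ j F e ≈ 0#
  ∂-vanishes j {e} deg≢2 =
    trans (reflexive (∂F≡cubic j e))
          (*-≈0ʳ _ (cubic-≢3 (isZero (e j) ℕ.+ supp e) (deg≢2 ∘ ℕₚ.suc-injective)))

  E2-vanishes : ∀ {n} {e : Exp n} → deg e ≢ 2 → E2 F e ≈ 0#
  E2-vanishes {e = e} deg≢2 = sumF-zero λ j →
    trans (reflexive (E2-term≡cubic j e))
          (*-≈0ʳ _ (cubic-≢3 (isZero (e j) ℕ.+ supp e) (deg≢2 ∘ ℕₚ.suc-injective)))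

  F-cong : ∀ {n} {e e′ : Exp n} → e ≗ e′ → F e ≡ F e′
  F-cong e≗e′ = ≡.cong₂ cubic (deg-cong e≗e′) (supp-cong e≗e′)

  ∂-cong : ∀ {n} j {e e′ : Exp n} → e ≗ e′ → ∂ j F e ≡ ∂ j F e′
  ∂-cong j e≗e′ = ≡.cong₂ (λ x y → fromℕ (suc x) * y) (e≗e′ j) (F-cong (bump-cong j e≗e′))

  E2-cong : ∀ {n} {e e′ : Exp n} → e ≗ e′ → E2 F e ≈ E2 F e′
  E2-cong e≗e′ = sumF-cong λ j →
    reflexive (≡.cong₂ (λ x y → fromℕ (suc x ℕ.* x) * y) (e≗e′ j) (F-cong (bump-cong j e≗e′)))

module Linear (R : RealField) where
  open RealField R
  open Poly R
  open OrderedField R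
  open FiniteSums R

  LinIndep-punchIn : ∀ {n k} (v : Fin (suc k) → Pol n) r →
                     (∀ λs → lin λs v ≈ₚ 0ₚ → λs r ≈ 0# → ∀ i → λs i ≈ 0#) →
                     LinIndep (v ∘ punchIn r)
  LinIndep-punchIn v r trivial λs λs-kernel i = begin
    λs i                    ≡⟨ insertAt-punchIn λs r 0# i ⟨
    λs′ (punchIn r i)       ≈⟨ trivial λs′ λs′-kernel (reflexive (insertAt-lookup λs r 0#)) (punchIn r i) ⟩
    0#                      ∎
    where
    λs′ = insertAt λs r 0#
    λs′-kernel : lin λs′ v ≈ₚ 0ₚ
    λs′-kernel e = begin
      lin λs′ v e                                                   ≈⟨ sumF-remove r (λ j → λs′ j * v j e) ⟩
      λs′ r * v r e + sumF (λ j → λs′ (punchIn r j) * v (punchIn r j) e)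
        ≈⟨ +-cong (*-congʳ (reflexive (insertAt-lookup λs r 0#)))
                  (sumF-cong (λ j → *-congʳ (reflexive (insertAt-punchIn λs r 0# j)))) ⟩
      0# * v r e + lin λs (v ∘ punchIn r) e                          ≈⟨ +-cong (zeroˡ _) (λs-kernel e) ⟩
      0# + 0#                                                       ≈⟨ +-identityʳ 0# ⟩
      0#                                                            ∎

  kernel⇒¬LinIndep : ∀ {n k} {v : Fin k → Pol n} {κ} → lin κ v ≈ₚ 0ₚ → ∀ r → ¬ κ r ≈ 0# →
                     ∀ {σ : Fin k → Fin k} → Injective _≡_ _≡_ σ → ¬ LinIndep (v ∘ σ)
  kernel⇒¬LinIndep {v = v} {κ} κ-kernel r κr≉0 {σ} σ-injective independent with injective⇒surjective σ-injective r
  ... | i , ≡.refl = κr≉0 (independent (κ ∘ σ) κσ-kernel i)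
    where
    κσ-kernel : lin (κ ∘ σ) (v ∘ σ) ≈ₚ 0ₚ
    κσ-kernel e = trans (sumF-permute (λ j → κ j * v j e) σ-injective) (κ-kernel e)

  proportional⇒¬LinIndep : ∀ {n m k} {v : Fin m → Pol n} (u : Pol n) (w : Fin m → Carrier) →
                           (∀ r → ¬ w r ≈ 0#) → (∀ r e → v r e ≈ w r * u e) →
                           (σ : Fin (suc (suc k)) → Fin m) → ¬ LinIndep (v ∘ σ)
  proportional⇒¬LinIndep {v = v} u w w≉0 v≈wu σ independent =
    w≉0 (σ (fsuc fzero)) (independent λs λs-kernel fzero)
    where
    w₀ = w (σ fzero)
    w₁ = w (σ (fsuc fzero))
    λs : Fin _ → Carrier
    λs fzero           = w₁
    λs (fsuc fzero)    = - w₀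
    λs (fsuc (fsuc _)) = 0#
    λs-kernel : lin λs (v ∘ σ) ≈ₚ 0ₚ
    λs-kernel e = begin
      w₁ * v (σ fzero) e + (- w₀ * v (σ (fsuc fzero)) e + sumF (λ j → 0# * v (σ (fsuc (fsuc j))) e))
        ≈⟨ +-cong (*-congˡ (v≈wu _ e))
                  (+-cong (*-congˡ (v≈wu _ e)) (sumF-zero (λ j → zeroˡ (v (σ (fsuc (fsuc j))) e)))) ⟩
      w₁ * (w₀ * u e) + (- w₀ * (w₁ * u e) + 0#)
        ≈⟨ solve 3 (λ x y z → y :* (x :* z) :+ (:- x :* (y :* z) :+ con (+ 0)) := con (+ 0)) refl w₀ w₁ (u e) ⟩
      0#                                                            ∎

module KernelEquations (R : RealField) (a b c : RealField.Carrier R) where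
  open RealField R
  open Poly R
  open OrderedField R
  open FiniteSums R
  open Exponents R
  open Cubic R a b c

  v : ∀ {n} → Fin (suc n) → Pol n
  v = family F

  family-cong : ∀ {n} (r : Fin (suc n)) {e e′ : Exp n} → e ≗ e′ → v r e ≈ v r e′
  family-cong fzero    e≗e′ = E2-cong e≗e′
  family-cong (fsuc j) e≗e′ = reflexive (∂-cong j e≗e′)

  family-vanishes : ∀ {n} (r : Fin (suc n)) {e : Exp n} → deg e ≢ 2 → v r e ≈ 0#
  family-vanishes fzero    {e} deg≢2 = E2-vanishes {e = e} deg≢2
  family-vanishes (fsuc j) {e} deg≢2 = ∂-vanishes j {e} deg≢2

  module _ {n} (λs : Fin (suc n) → Carrier) where
    μ : Carrier
    μ = λs fzero

    ℓ : Fin n → Carrier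
    ℓ = λs ∘ fsuc

    Λ : Carrier
    Λ = sumF ℓ

    lin-square : ∀ i → lin λs v (square i) ≈ μ * (fromℕ 6 * a) + (Λ * b + ℓ i * α)
    lin-square i = +-cong (*-congˡ (E2-square i))
      (trans (sumF-*δ-shift ℓ (λ j → ∂ j F (square i)) (λ _ → b) i α (∂-square i)) (+-congʳ (sumF-*ʳ ℓ b)))

    lin-mixed : ∀ {i k} → i ≢ k → lin λs v (mixed i k) ≈ μ * (fromℕ 4 * b) + (Λ * c + ℓ i * β + ℓ k * β)
    lin-mixed {i} {k} i≢k = +-cong (*-congˡ (E2-mixed i≢k)) (begin
      sumF (λ j → ℓ j * ∂ j F (mixed i k))                 ≈⟨ sumF-*δ-shift ℓ _ _ k β (∂-mixed i≢k) ⟩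
      sumF (λ j → ℓ j * (c + δ i β j)) + ℓ k * β
        ≈⟨ +-congʳ (sumF-*δ-shift ℓ _ (λ _ → c) i β (λ _ → refl)) ⟩
      sumF (λ j → ℓ j * c) + ℓ i * β + ℓ k * β             ≈⟨ +-congʳ (+-congʳ (sumF-*ʳ ℓ c)) ⟩
      Λ * c + ℓ i * β + ℓ k * β                            ∎)

    lin-vanishes : ∀ {e} → deg e ≢ 2 → lin λs v e ≈ 0#
    lin-vanishes {e} deg≢2 = sumF-zero (λ r → *-≈0ʳ (λs r) (family-vanishes r {e} deg≢2))

    lin-cong : ∀ {e e′} → e ≗ e′ → lin λs v e ≈ lin λs v e′
    lin-cong e≗e′ = sumF-cong (λ r → *-congˡ {λs r} (family-cong r e≗e′))

module Exception (R : RealField) (a b c : RealField.Carrier R) (m : ℕ) where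
  open RealField R
  open Poly R
  open OrderedField R
  open FiniteSums R
  open Exponents R
  open Cubic R a b c
  open KernelEquations R a b c
  open Linear R

  n : ℕ
  n = 3 ℕ.+ m

  ν : Carrier
  ν = fromℕ n

  D : Carrier
  D = fromℕ 3 * a * (fromℕ 2 * b + (ν - fromℕ 2) * c) - fromℕ 2 * (ν - fromℕ 1) * b * b

  A₁₁ A₁₂ A₂₁ A₂₂ : Carrier
  A₁₁ = fromℕ 6 * a
  A₁₂ = ν * b + α
  A₂₁ = fromℕ 4 * b
  A₂₂ = ν * c + β + β

  det≈2D : A₁₁ * A₂₂ - A₁₂ * A₂₁ ≈ fromℕ 2 * D
  det≈2D = solve 4 (λ a b c ν →
      con (+ 6) :* a :* (ν :* c :+ (con (+ 2) :* b :- c) :+ (con (+ 2) :* b :- c))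
        :- (ν :* b :+ (con (+ 3) :* a :- b)) :* (con (+ 4) :* b)
    := con (+ 2) :* (con (+ 3) :* a :* (con (+ 2) :* b :+ (ν :- con (+ 2)) :* c)
                       :- con (+ 2) :* (ν :- con (+ 1)) :* b :* b))
    refl a b c ν

  D≈α,β : D ≈ fromℕ 2 * (ν - fromℕ 1) * b * α - fromℕ 3 * (ν - fromℕ 2) * a * β
  D≈α,β = solve 4 (λ a b c ν →
      con (+ 3) :* a :* (con (+ 2) :* b :+ (ν :- con (+ 2)) :* c) :- con (+ 2) :* (ν :- con (+ 1)) :* b :* b
    := con (+ 2) :* (ν :- con (+ 1)) :* b :* (con (+ 3) :* a :- b)
         :- con (+ 3) :* (ν :- con (+ 2)) :* a :* (con (+ 2) :* b :- c))
    refl a b c ν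

  Degenerate : Set
  Degenerate = α ≈ 0# × β ≈ 0#

  α≈0⇒b≈3a : α ≈ 0# → b ≈ fromℕ 3 * a
  α≈0⇒b≈3a α≈0 = sym (x∙y⁻¹≈ε⇒x≈y _ _ α≈0)

  β≈0⇒c≈2b : β ≈ 0# → c ≈ fromℕ 2 * b
  β≈0⇒c≈2b β≈0 = sym (x∙y⁻¹≈ε⇒x≈y _ _ β≈0)

  degenerate⇒D≈0 : Degenerate → D ≈ 0#
  degenerate⇒D≈0 (α≈0 , β≈0) = trans D≈α,β (combination-≈0 _ _ α≈0 β≈0)

  module _ {λs : Fin (suc n) → Carrier} {l : Carrier} (ℓ≈l : ∀ j → ℓ λs j ≈ l) where
    Λ≈νl : Λ λs ≈ ν * l
    Λ≈νl = trans (sumF-cong ℓ≈l) (sumF-const {n} l)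

    lin-square-constant : ∀ i → lin λs v (square i) ≈ A₁₁ * μ λs + A₁₂ * l
    lin-square-constant i = trans (lin-square λs i) (begin
      μ λs * (fromℕ 6 * a) + (Λ λs * b + ℓ λs i * α) ≈⟨ +-congˡ (+-cong (*-congʳ Λ≈νl) (*-congʳ (ℓ≈l i))) ⟩
      μ λs * (fromℕ 6 * a) + (ν * l * b + l * α)     ≈⟨ solve 5 (λ a b ν μ l →
          μ :* (con (+ 6) :* a) :+ (ν :* l :* b :+ l :* (con (+ 3) :* a :- b))
        := con (+ 6) :* a :* μ :+ (ν :* b :+ (con (+ 3) :* a :- b)) :* l) refl a b ν (μ λs) l ⟩
      A₁₁ * μ λs + A₁₂ * l                          ∎)

    lin-mixed-constant : ∀ {i k} → i ≢ k → lin λs v (mixed i k) ≈ A₂₁ * μ λs + A₂₂ * l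
    lin-mixed-constant {i} {k} i≢k = trans (lin-mixed λs i≢k) (begin
      μ λs * (fromℕ 4 * b) + (Λ λs * c + ℓ λs i * β + ℓ λs k * β)
        ≈⟨ +-congˡ (+-cong (+-cong (*-congʳ Λ≈νl) (*-congʳ (ℓ≈l i))) (*-congʳ (ℓ≈l k))) ⟩
      μ λs * (fromℕ 4 * b) + (ν * l * c + l * β + l * β)
        ≈⟨ solve 5 (λ b c ν μ l →
             μ :* (con (+ 4) :* b) :+ (ν :* l :* c :+ l :* (con (+ 2) :* b :- c) :+ l :* (con (+ 2) :* b :- c))
           := con (+ 4) :* b :* μ :+ (ν :* c :+ (con (+ 2) :* b :- c) :+ (con (+ 2) :* b :- c)) :* l) refl b c ν (μ λs) l ⟩
      A₂₁ * μ λs + A₂₂ * l ∎)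

  module _ (λs : Fin (suc n) → Carrier) (kernel : lin λs v ≈ₚ 0ₚ) where
    private
      square≈0 : ∀ i → μ λs * (fromℕ 6 * a) + (Λ λs * b + ℓ λs i * α) ≈ 0#
      square≈0 i = trans (sym (lin-square λs i)) (kernel (square i))

      mixed≈0 : ∀ {i k} → i ≢ k → μ λs * (fromℕ 4 * b) + (Λ λs * c + ℓ λs i * β + ℓ λs k * β) ≈ 0#
      mixed≈0 {i} {k} i≢k = trans (sym (lin-mixed λs i≢k)) (kernel (mixed i k))

    α-difference : ∀ j k → α * (ℓ λs j - ℓ λs k) ≈ 0#
    α-difference j k = trans
      (solve 6 (λ a b μ Λ x y → (con (+ 3) :* a :- b) :* (x :- y) :=
          (μ :* (con (+ 6) :* a) :+ (Λ :* b :+ x :* (con (+ 3) :* a :- b)))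
            :- (μ :* (con (+ 6) :* a) :+ (Λ :* b :+ y :* (con (+ 3) :* a :- b))))
        refl a b (μ λs) (Λ λs) (ℓ λs j) (ℓ λs k))
      (difference-≈0 (square≈0 j) (square≈0 k))

    β-difference : ∀ j k → β * (ℓ λs j - ℓ λs k) ≈ 0#
    β-difference j k with j Fin.≟ k
    ... | yes ≡.refl = solve 2 (λ β x → β :* (x :- x) := con (+ 0)) refl β (ℓ λs j)
    ... | no j≢k with third-index j k
    ...   | l , l≢j , l≢k = trans
      (solve 7 (λ b c μ Λ x y z → (con (+ 2) :* b :- c) :* (x :- y) :=
          (μ :* (con (+ 4) :* b) :+ (Λ :* c :+ x :* (con (+ 2) :* b :- c) :+ z :* (con (+ 2) :* b :- c)))
            :- (μ :* (con (+ 4) :* b) :+ (Λ :* c :+ y :* (con (+ 2) :* b :- c) :+ z :* (con (+ 2) :* b :- c))))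
        refl b c (μ λs) (Λ λs) (ℓ λs j) (ℓ λs k) (ℓ λs l))
      (difference-≈0 (mixed≈0 (l≢j ∘ ≡.sym)) (mixed≈0 (l≢k ∘ ≡.sym)))

    ℓ-constant : ¬ Degenerate → ∀ j → ℓ λs j ≈ ℓ λs fzero
    ℓ-constant ¬degenerate j =
      x∙y⁻¹≈ε⇒x≈y _ _ (*-cancelˡ-≈0-either ¬degenerate (α-difference j fzero) (β-difference j fzero))

    reduced-system : ¬ Degenerate →
                     A₁₁ * μ λs + A₁₂ * ℓ λs fzero ≈ 0# × A₂₁ * μ λs + A₂₂ * ℓ λs fzero ≈ 0#
    reduced-system ¬degenerate =
      trans (sym (lin-square-constant {λs} ℓ≈ℓ₀ fzero)) (kernel (square fzero)) ,
      trans (sym (lin-mixed-constant {λs} ℓ≈ℓ₀ 0≢1)) (kernel (mixed fzero (fsuc fzero)))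
      where
      ℓ≈ℓ₀ = ℓ-constant ¬degenerate
      0≢1 : fzero ≢ fsuc fzero
      0≢1 ()

  D≉0⇒LinIndep : ¬ D ≈ 0# → LinIndep (v {n})
  D≉0⇒LinIndep D≉0 λs kernel = λs≈0
    where
    ¬degenerate = D≉0 ∘ degenerate⇒D≈0
    det≉0 : ¬ A₁₁ * A₂₂ - A₁₂ * A₂₁ ≈ 0#
    det≉0 det≈0 = D≉0 (*-cancelˡ-≈0 (fromℕ-suc≉0 1) (trans (sym det≈2D) det≈0))
    trivial = det≉0⇒trivial-solution det≉0 (proj₁ (reduced-system λs kernel ¬degenerate))
                                           (proj₂ (reduced-system λs kernel ¬degenerate))
    λs≈0 : ∀ r → λs r ≈ 0#
    λs≈0 fzero    = proj₁ trivial
    λs≈0 (fsuc j) = trans (ℓ-constant λs kernel ¬degenerate j) (proj₂ trivial)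

  solution⇒kernel : ∀ {x y} → A₁₁ * x + A₁₂ * y ≈ 0# → A₂₁ * x + A₂₂ * y ≈ 0# →
                    lin (x ∷ replicate n y) v ≈ₚ 0ₚ
  solution⇒kernel {x} {y} row₁≈0 row₂≈0 e with deg e ℕ.≟ 2
  ... | no deg≢2 = lin-vanishes (x ∷ replicate n y) {e} deg≢2
  ... | yes deg≡2 with deg≡2⇒Degree2 e deg≡2
  ...   | inj₁ (i , e≗square) = begin
    lin (x ∷ replicate n y) v e          ≈⟨ lin-cong (x ∷ replicate n y) e≗square ⟩
    lin (x ∷ replicate n y) v (square i) ≈⟨ lin-square-constant {x ∷ replicate n y} (λ _ → refl) i ⟩
    A₁₁ * x + A₁₂ * y                    ≈⟨ row₁≈0 ⟩
    0#                                   ∎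
  ...   | inj₂ (i , k , i≢k , e≗mixed) = begin
    lin (x ∷ replicate n y) v e           ≈⟨ lin-cong (x ∷ replicate n y) e≗mixed ⟩
    lin (x ∷ replicate n y) v (mixed i k) ≈⟨ lin-mixed-constant {x ∷ replicate n y} (λ _ → refl) i≢k ⟩
    A₂₁ * x + A₂₂ * y                     ≈⟨ row₂≈0 ⟩
    0#                                    ∎

  nonzero-entry : ∀ {x y} → ¬ (x ≈ 0# × y ≈ 0#) → ∃ λ r → ¬ (x ∷ replicate n y) r ≈ 0#
  nonzero-entry {x} nontrivial with x ≟ 0#
  ... | no x≉0  = fzero , x≉0
  ... | yes x≈0 = fsuc fzero , λ y≈0 → nontrivial (x≈0 , y≈0)

  -- Destructured by auxiliary functions rather than by with: with-abstraction over a goal such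
  -- as lin κ v ≈ₚ 0ₚ or LinIndep (v ∘ σ) normalises it, which is prohibitively expensive.
  D≈0⇒kernel : D ≈ 0# → ∃₂ λ (κ : Fin (suc n) → Carrier) r → lin κ v ≈ₚ 0ₚ × ¬ κ r ≈ 0#
  D≈0⇒kernel D≈0 = from-solution
    (det≈0⇒nontrivial-solution A₁₁ A₁₂ A₂₁ A₂₂ (trans det≈2D (*-≈0ʳ (fromℕ 2) D≈0)))
    where
    from-solution : (∃₂ λ x y → ¬ (x ≈ 0# × y ≈ 0#) × A₁₁ * x + A₁₂ * y ≈ 0# × A₂₁ * x + A₂₂ * y ≈ 0#) →
                    ∃₂ λ (κ : Fin (suc n) → Carrier) r → lin κ v ≈ₚ 0ₚ × ¬ κ r ≈ 0#
    from-solution (x , y , nontrivial , row₁≈0 , row₂≈0) =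
      let r , κr≉0 = nonzero-entry nontrivial in (x ∷ replicate n y) , r , solution⇒kernel row₁≈0 row₂≈0 , κr≉0

  trivial-if-∂₀-coefficient≈0 : ¬ (a ≈ 0# × b ≈ 0#) → ¬ Degenerate →
                       ∀ λs → lin λs v ≈ₚ 0ₚ → λs (fsuc fzero) ≈ 0# → ∀ r → λs r ≈ 0#
  trivial-if-∂₀-coefficient≈0 ¬a≈0×b≈0 ¬degenerate λs kernel l≈0 = λs≈0
    where
    rows = reduced-system λs kernel ¬degenerate
    ¬column₁≈0 : ¬ (A₁₁ ≈ 0# × A₂₁ ≈ 0#)
    ¬column₁≈0 (6a≈0 , 4b≈0) =
      ¬a≈0×b≈0 (*-cancelˡ-≈0 (fromℕ-suc≉0 5) 6a≈0 , *-cancelˡ-≈0 (fromℕ-suc≉0 3) 4b≈0)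
    μ≈0 : μ λs ≈ 0#
    μ≈0 = *-cancelˡ-≈0-either ¬column₁≈0 (+-cancelʳ-≈0 (*-≈0ʳ A₁₂ l≈0) (proj₁ rows))
                                 (+-cancelʳ-≈0 (*-≈0ʳ A₂₂ l≈0) (proj₂ rows))
    λs≈0 : ∀ r → λs r ≈ 0#
    λs≈0 fzero    = μ≈0
    λs≈0 (fsuc j) = trans (ℓ-constant λs kernel ¬degenerate j) l≈0

  trivial-if-E2-coefficient≈0 : a ≈ 0# → b ≈ 0# → ¬ c ≈ 0# →
                       ∀ λs → lin λs v ≈ₚ 0ₚ → λs fzero ≈ 0# → ∀ r → λs r ≈ 0#
  trivial-if-E2-coefficient≈0 a≈0 b≈0 c≉0 λs kernel μ≈0 = λs≈0
    where
    2b≈0 : fromℕ 2 * b ≈ 0#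
    2b≈0 = *-≈0ʳ (fromℕ 2) b≈0
    ¬degenerate : ¬ Degenerate
    ¬degenerate (_ , β≈0) = c≉0 (trans (β≈0⇒c≈2b β≈0) 2b≈0)
    A₂₂≈[ν-2]c : A₂₂ ≈ (ν - fromℕ 2) * c
    A₂₂≈[ν-2]c = begin
      ν * c + β + β                        ≈⟨ solve 3 (λ b c ν → ν :* c :+ (con (+ 2) :* b :- c) :+ (con (+ 2) :* b :- c)
                                                          := (ν :- con (+ 2)) :* c :+ con (+ 2) :* (con (+ 2) :* b)) refl b c ν ⟩
      (ν - fromℕ 2) * c + fromℕ 2 * (fromℕ 2 * b) ≈⟨ +-congˡ (*-≈0ʳ (fromℕ 2) 2b≈0) ⟩
      (ν - fromℕ 2) * c + 0#               ≈⟨ +-identityʳ _ ⟩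
      (ν - fromℕ 2) * c                    ∎
    A₂₂≉0 : ¬ A₂₂ ≈ 0#
    A₂₂≉0 A₂₂≈0 = *-≉0 ν-2≉0 c≉0 (trans (sym A₂₂≈[ν-2]c) A₂₂≈0)
      where
      ν-2≉0 : ¬ ν - fromℕ 2 ≈ 0#
      ν-2≉0 = fromℕ-suc≉0 m ∘ trans (fromℕ-∸ {n} {2} (ℕ.s≤s (ℕ.s≤s ℕ.z≤n)))
    l≈0 : ℓ λs fzero ≈ 0#
    l≈0 = *-cancelˡ-≈0 A₂₂≉0 (+-cancelˡ-≈0 (*-≈0ʳ A₂₁ μ≈0) (proj₂ (reduced-system λs kernel ¬degenerate)))
    λs≈0 : ∀ r → λs r ≈ 0#
    λs≈0 fzero    = μ≈0
    λs≈0 (fsuc j) = trans (ℓ-constant λs kernel ¬degenerate j) l≈0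

  LinIndep-subfamily : ¬ (a ≈ 0# × b ≈ 0# × c ≈ 0#) → ¬ Degenerate →
                       ∃ λ (σ : Fin n → Fin (suc n)) → Injective _≡_ _≡_ σ × LinIndep (v ∘ σ)
  LinIndep-subfamily ¬abc≈0 ¬degenerate with (a ≟ 0#) ×-dec (b ≟ 0#)
  ... | yes (a≈0 , b≈0) = punchIn fzero , Finₚ.punchIn-injective fzero _ _ ,
    LinIndep-punchIn v fzero (trivial-if-E2-coefficient≈0 a≈0 b≈0 (λ c≈0 → ¬abc≈0 (a≈0 , b≈0 , c≈0)))
  ... | no ¬a≈0×b≈0     = punchIn (fsuc fzero) , Finₚ.punchIn-injective (fsuc fzero) _ _ ,
    LinIndep-punchIn v (fsuc fzero) (trivial-if-∂₀-coefficient≈0 ¬a≈0×b≈0 ¬degenerate)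

  sameAs136⇒degenerate : SameAs136 a b c → Degenerate
  sameAs136⇒degenerate (t , _ , a≈t , b≈3t , c≈6t) =
    trans (+-cong (*-congˡ a≈t) (-‿cong b≈3t))
          (solve 1 (λ t → con (+ 3) :* t :- t :* con (+ 3) := con (+ 0)) refl t) ,
    trans (+-cong (*-congˡ b≈3t) (-‿cong c≈6t))
          (solve 1 (λ t → con (+ 2) :* (t :* con (+ 3)) :- t :* con (+ 6) := con (+ 0)) refl t)

  degenerate⇒sameAs136 : ¬ (a ≈ 0# × b ≈ 0# × c ≈ 0#) → Degenerate → SameAs136 a b c
  degenerate⇒sameAs136 ¬abc≈0 (α≈0 , β≈0) = a , a≉0 , refl , trans b≈3a (*-comm _ _) , c≈a6
    where
    b≈3a = α≈0⇒b≈3a α≈0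
    c≈2b = β≈0⇒c≈2b β≈0
    c≈a6 : c ≈ a * fromℕ 6
    c≈a6 = trans c≈2b (trans (*-congˡ b≈3a) (solve 1 (λ a → con (+ 2) :* (con (+ 3) :* a) := a :* con (+ 6)) refl a))
    a≉0 : ¬ a ≈ 0#
    a≉0 a≈0 = ¬abc≈0 (a≈0 , b≈0 , trans c≈2b (*-≈0ʳ _ b≈0))
      where b≈0 = trans b≈3a (*-≈0ʳ _ a≈0)

  weight : Fin (suc n) → Carrier
  weight fzero    = fromℕ 2
  weight (fsuc _) = fromℕ 1

  module _ (degenerate : Degenerate) where
    private
      α≈0 = proj₁ degenerate
      β≈0 = proj₂ degenerate

    family-square-degenerate : ∀ (i : Fin n) r → v r (square i) ≈ weight r * b
    family-square-degenerate i fzero = begin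
      E2 F (square i)           ≈⟨ E2-square i ⟩
      fromℕ 6 * a               ≈⟨ solve 1 (λ a → con (+ 6) :* a := con (+ 2) :* (con (+ 3) :* a)) refl a ⟩
      fromℕ 2 * (fromℕ 3 * a)   ≈⟨ *-congˡ (α≈0⇒b≈3a α≈0) ⟨
      fromℕ 2 * b               ∎
    family-square-degenerate i (fsuc j) = begin
      ∂ j F (square i)          ≈⟨ ∂-square i j ⟩
      b + δ i α j               ≈⟨ +-congˡ (δ-≈0 i j α≈0) ⟩
      b + 0#                    ≈⟨ solve 1 (λ b → b :+ con (+ 0) := con (+ 1) :* b) refl b ⟩
      fromℕ 1 * b               ∎

    family-mixed-degenerate : ∀ {i k : Fin n} → i ≢ k → ∀ r → v r (mixed i k) ≈ weight r * c
    family-mixed-degenerate {i} {k} i≢k fzero = begin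
      E2 F (mixed i k)          ≈⟨ E2-mixed i≢k ⟩
      fromℕ 4 * b               ≈⟨ solve 1 (λ b → con (+ 4) :* b := con (+ 2) :* (con (+ 2) :* b)) refl b ⟩
      fromℕ 2 * (fromℕ 2 * b)   ≈⟨ *-congˡ (β≈0⇒c≈2b β≈0) ⟨
      fromℕ 2 * c               ∎
    family-mixed-degenerate {i} {k} i≢k (fsuc j) = begin
      ∂ j F (mixed i k)         ≈⟨ ∂-mixed i≢k j ⟩
      c + δ i β j + δ k β j     ≈⟨ +-cong (+-congˡ (δ-≈0 i j β≈0)) (δ-≈0 k j β≈0) ⟩
      c + 0# + 0#               ≈⟨ solve 1 (λ c → c :+ con (+ 0) :+ con (+ 0) := con (+ 1) :* c) refl c ⟩
      fromℕ 1 * c               ∎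

    ≗-proportional : ∀ {e e′ : Exp n} {x} → e ≗ e′ → (∀ r → v r e′ ≈ weight r * x) →
                     ∀ r → v r e ≈ weight r * ∂ fzero F e
    ≗-proportional {e} {e′} {x} e≗e′ v≈wx r = begin
      v r e                     ≈⟨ family-cong r e≗e′ ⟩
      v r e′                    ≈⟨ v≈wx r ⟩
      weight r * x              ≈⟨ *-congˡ x≈∂₀ ⟩
      weight r * ∂ fzero F e    ∎
      where
      x≈∂₀ : x ≈ ∂ fzero F e
      x≈∂₀ = begin
        x                       ≈⟨ solve 1 (λ x → x := con (+ 1) :* x) refl x ⟩
        fromℕ 1 * x             ≈⟨ v≈wx (fsuc fzero) ⟨
        ∂ fzero F e′            ≈⟨ family-cong (fsuc fzero) e≗e′ ⟨
        ∂ fzero F e             ∎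

    degenerate⇒proportional : ∀ r (e : Exp n) → v r e ≈ weight r * ∂ fzero F e
    degenerate⇒proportional r e with deg e ℕ.≟ 2
    ... | no deg≢2 =
      trans (family-vanishes r {e} deg≢2) (sym (*-≈0ʳ (weight r) (family-vanishes (fsuc fzero) {e} deg≢2)))
    ... | yes deg≡2 with deg≡2⇒Degree2 e deg≡2
    ...   | inj₁ (i , e≗square)          = ≗-proportional e≗square (family-square-degenerate i) r
    ...   | inj₂ (i , k , i≢k , e≗mixed) = ≗-proportional e≗mixed (family-mixed-degenerate i≢k) r

  ¬LinIndep⇒D≈0 : ¬ LinIndep (v {n}) → D ≈ 0#
  ¬LinIndep⇒D≈0 dependent = decidable-stable (D ≟ 0#) (λ D≉0 → dependent (D≉0⇒LinIndep D≉0))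

  D≈0⇒¬LinIndep : D ≈ 0# → ∀ {σ : Fin (suc n) → Fin (suc n)} → Injective _≡_ _≡_ σ → ¬ LinIndep (v ∘ σ)
  D≈0⇒¬LinIndep D≈0 = from-kernel (D≈0⇒kernel D≈0)
    where
    from-kernel : (∃₂ λ (κ : Fin (suc n) → Carrier) r → lin κ v ≈ₚ 0ₚ × ¬ κ r ≈ 0#) →
                  ∀ {σ : Fin (suc n) → Fin (suc n)} → Injective _≡_ _≡_ σ → ¬ LinIndep (v ∘ σ)
    from-kernel (κ , r , kernel , κr≉0) = kernel⇒¬LinIndep {v = v} {κ} kernel r κr≉0

  IsException⇔ : ¬ (a ≈ 0# × b ≈ 0# × c ≈ 0#) → IsException n a b c ⇔ (¬ SameAs136 a b c × D ≈ 0#)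
  IsException⇔ ¬abc≈0 = mk⇔
    (λ ((σ , _ , independent) , dependent) →
      (λ same → proportional⇒¬LinIndep (∂ fzero F) weight weight≉0
                  (degenerate⇒proportional (sameAs136⇒degenerate same)) σ independent) ,
      ¬LinIndep⇒D≈0 (dependent id id))
    (λ (¬same , D≈0) →
      LinIndep-subfamily ¬abc≈0 (¬same ∘ degenerate⇒sameAs136 ¬abc≈0) ,
      λ σ → D≈0⇒¬LinIndep D≈0)
    where
    weight≉0 : ∀ r → ¬ weight r ≈ 0#
    weight≉0 fzero    = fromℕ-suc≉0 1
    weight≉0 (fsuc _) = fromℕ-suc≉0 0

module Arithmetic where
  open import Data.Nat using (_+_; _*_; _∸_)
  open ≡.≡-Reasoning
  open import Algebra.Properties.CommutativeSemigroup ℕₚ.*-commutativeSemigroup using (xy∙z≈xz∙y; x∙yz≈y∙xz)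

  *-shuffle : ∀ x y z → x * y * (2 * z) ≡ x * z * (y * 2)
  *-shuffle = solve-∀

  gcd[m+kn,n]≡gcd[m,n] : ∀ m k n → gcd (m + k * n) n ≡ gcd m n
  gcd[m+kn,n]≡gcd[m,n] m k n = ∣-antisym
    (gcd-greatest (∣m+n∣m⇒∣n (≡.subst (gcd (m + k * n) n ∣_) (ℕₚ.+-comm m (k * n)) (gcd[m,n]∣m (m + k * n) n))
                             (∣n⇒∣m*n k (gcd[m,n]∣n (m + k * n) n)))
                  (gcd[m,n]∣n (m + k * n) n))
    (gcd-greatest (∣m∣n⇒∣m+n (gcd[m,n]∣m m n) (∣n⇒∣m*n k (gcd[m,n]∣n m n))) (gcd[m,n]∣n m n))

  coprime⇒gcd[m,n*o]≡gcd[m,o] : ∀ {m n} o → Coprime m n → gcd m (n * o) ≡ gcd m o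
  coprime⇒gcd[m,n*o]≡gcd[m,o] {m} {n} o m⊥n = ∣-antisym
    (gcd-greatest (gcd[m,n]∣m m (n * o)) (coprime-divisor g⊥n (gcd[m,n]∣n m (n * o))))
    (gcd-greatest (gcd[m,n]∣m m o) (∣n⇒∣m*n n (gcd[m,n]∣n m o)))
    where
    g⊥n : Coprime (gcd m (n * o)) n
    g⊥n (d∣g , d∣n) = m⊥n (∣-trans d∣g (gcd[m,n]∣m m (n * o)) , d∣n)

  parity : ∀ p → ∃ λ t → p ≡ t * 2 ⊎ p ≡ 1 + t * 2
  parity zero          = 0 , inj₁ ≡.refl
  parity (suc zero)    = 0 , inj₂ ≡.refl
  parity (suc (suc p)) with parity p
  ... | t , inj₁ p≡2t   = suc t , inj₁ (≡.cong (suc ∘ suc) p≡2t)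
  ... | t , inj₂ p≡1+2t = suc t , inj₂ (≡.cong (suc ∘ suc) p≡1+2t)

  Normalises : ℕ → ℕ → Set
  Normalises n k = n₁ n * n₂ n * k ≡ 6 × n₁ n * n₃ n * k ≡ 3 * (n ∸ 2) × n₄ n * k ≡ 2 * (n ∸ 1)

  module _ (p : ℕ) where
    private
      n g : ℕ
      n = suc p
      g = gcd p 3
      instance
        g≢0 : NonZero g
        g≢0 = ≢-nonZero (gcd[m,n]≢0 p 3 (inj₂ λ ()))
        gcd[p,6]≢0 : NonZero (gcd p 6)
        gcd[p,6]≢0 = ≢-nonZero (gcd[m,n]≢0 p 6 (inj₂ λ ()))

    n₁*g≡3 : n₁ n * g ≡ 3
    n₁*g≡3 = ≡.subst (λ d → n₁ n * d ≡ 3) gcd[n+2,3]≡g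
      (m/n*n≡m {{≢-nonZero (gcd[m,n]≢0 (n + 2) 3 (inj₂ λ ()))}} (gcd[m,n]∣n (n + 2) 3))
      where
      gcd[n+2,3]≡g : gcd (n + 2) 3 ≡ g
      gcd[n+2,3]≡g = ≡.trans (≡.cong (λ x → gcd x 3) (≡.sym (ℕₚ.+-suc p 2))) (gcd[m+kn,n]≡gcd[m,n] p 1 3)

    n₂≡gcd[p,2] : n₂ n ≡ gcd p 2
    n₂≡gcd[p,2] = ≡.trans (≡.cong (λ x → gcd x p) n+1≡2+1*p)
                          (≡.trans (gcd[m+kn,n]≡gcd[m,n] 2 1 p) (gcd-comm 2 p))
      where
      n+1≡2+1*p : n + 1 ≡ 2 + 1 * p
      n+1≡2+1*p = ≡.cong suc (≡.trans (ℕₚ.+-comm p 1) (≡.cong suc (≡.sym (ℕₚ.+-identityʳ p))))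

    n₃≡ : ∀ {r} → n % 2 ≡ r → n₃ n ≡ (if does (r ℕ.≟ 0) then (n ∸ 2) / 2 else n ∸ 2)
    n₃≡ = ≡.cong (λ r → if does (r ℕ.≟ 0) then (n ∸ 2) / 2 else n ∸ 2)

    n₄≡ : ∀ {r} → n % 2 ≡ r → n₄ n ≡ (if does (r ℕ.≟ 0) then p / gcd p 6 else (2 * n ∸ 2) / g)
    n₄≡ = ≡.cong (λ r → if does (r ℕ.≟ 0) then p / gcd p 6 else (2 * n ∸ 2) / g)

    odd⇒normalises : ∀ {t} → p ≡ t * 2 → Normalises n g
    odd⇒normalises {t} ≡.refl = e₁ , e₂ , e₃
      where
      n%2≡1 : n % 2 ≡ 1
      n%2≡1 = [m+kn]%n≡m%n 1 t 2
      e₁ : n₁ n * n₂ n * g ≡ 6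
      e₁ = begin
        n₁ n * n₂ n * g ≡⟨ ≡.cong (λ x → n₁ n * x * g) (≡.trans n₂≡gcd[p,2] (gcd[m+kn,n]≡gcd[m,n] 0 t 2)) ⟩
        n₁ n * 2 * g    ≡⟨ xy∙z≈xz∙y (n₁ n) 2 g ⟩
        n₁ n * g * 2    ≡⟨ ≡.cong (_* 2) n₁*g≡3 ⟩
        6               ∎
      e₂ : n₁ n * n₃ n * g ≡ 3 * (n ∸ 2)
      e₂ = begin
        n₁ n * n₃ n * g        ≡⟨ ≡.cong (λ x → n₁ n * x * g) (n₃≡ n%2≡1) ⟩
        n₁ n * (n ∸ 2) * g     ≡⟨ xy∙z≈xz∙y (n₁ n) (n ∸ 2) g ⟩
        n₁ n * g * (n ∸ 2)     ≡⟨ ≡.cong (_* (n ∸ 2)) n₁*g≡3 ⟩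
        3 * (n ∸ 2)            ∎
      2n-2≡2p : 2 * n ∸ 2 ≡ 2 * p
      2n-2≡2p = ≡.cong (_∸ 2) (ℕₚ.*-suc 2 p)
      e₃ : n₄ n * g ≡ 2 * (n ∸ 1)
      e₃ = begin
        n₄ n * g                  ≡⟨ ≡.cong (_* g) (n₄≡ n%2≡1) ⟩
        (2 * n ∸ 2) / g * g       ≡⟨ m/n*n≡m (≡.subst (g ∣_) (≡.sym 2n-2≡2p) (∣n⇒∣m*n 2 (gcd[m,n]∣m p 3))) ⟩
        2 * n ∸ 2                 ≡⟨ 2n-2≡2p ⟩
        2 * p                     ∎

    even⇒normalises : ∀ {t} → p ≡ 1 + t * 2 → Normalises n (2 * g)
    even⇒normalises {t} ≡.refl = e₁ , e₂ , e₃
      where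
      n%2≡0 : n % 2 ≡ 0
      n%2≡0 = [m+kn]%n≡m%n 0 (suc t) 2
      gcd[p,2]≡1 : gcd p 2 ≡ 1
      gcd[p,2]≡1 = gcd[m+kn,n]≡gcd[m,n] 1 t 2
      e₁ : n₁ n * n₂ n * (2 * g) ≡ 6
      e₁ = begin
        n₁ n * n₂ n * (2 * g)   ≡⟨ ≡.cong (λ x → n₁ n * x * (2 * g)) (≡.trans n₂≡gcd[p,2] gcd[p,2]≡1) ⟩
        n₁ n * 1 * (2 * g)      ≡⟨ *-shuffle (n₁ n) 1 g ⟩
        n₁ n * g * 2            ≡⟨ ≡.cong (_* 2) n₁*g≡3 ⟩
        6                       ∎
      e₂ : n₁ n * n₃ n * (2 * g) ≡ 3 * (n ∸ 2)
      e₂ = begin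
        n₁ n * n₃ n * (2 * g)   ≡⟨ ≡.cong (λ x → n₁ n * x * (2 * g)) (≡.trans (n₃≡ n%2≡0) (m*n/n≡m t 2)) ⟩
        n₁ n * t * (2 * g)      ≡⟨ *-shuffle (n₁ n) t g ⟩
        n₁ n * g * (t * 2)      ≡⟨ ≡.cong (_* (t * 2)) n₁*g≡3 ⟩
        3 * (t * 2)             ∎
      gcd[p,6]≡g : gcd p 6 ≡ g
      gcd[p,6]≡g = coprime⇒gcd[m,n*o]≡gcd[m,o] {p} {2} 3 (gcd≡1⇒coprime gcd[p,2]≡1)
      e₃ : n₄ n * (2 * g) ≡ 2 * (n ∸ 1)
      e₃ = begin
        n₄ n * (2 * g)               ≡⟨ x∙yz≈y∙xz (n₄ n) 2 g ⟩
        2 * (n₄ n * g)               ≡⟨ ≡.cong (λ x → 2 * (n₄ n * x)) (≡.sym gcd[p,6]≡g) ⟩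
        2 * (n₄ n * gcd p 6)         ≡⟨ ≡.cong (λ x → 2 * (x * gcd p 6)) (n₄≡ n%2≡0) ⟩
        2 * (p / gcd p 6 * gcd p 6)  ≡⟨ ≡.cong (2 *_) (m/n*n≡m (gcd[m,n]∣m p 6)) ⟩
        2 * p                        ∎

    normalising-factor : ∃ λ k → NonZero k × Normalises n k
    normalising-factor with parity p
    ... | t , inj₁ p≡2t   = g , g≢0 , odd⇒normalises {t} p≡2t
    ... | t , inj₂ p≡1+2t = 2 * g , ℕₚ.m*n≢0 2 g , even⇒normalises {t} p≡1+2t

module Normalisation (R : RealField) (a b c : RealField.Carrier R) (m : ℕ) where
  open RealField R
  open Poly R using (fromℕ)
  open OrderedField R
  open Exception R a b c m using (n; ν; D)
  open Arithmetic using (normalising-factor)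

  fromℕ-*³ : ∀ x y z → fromℕ (x ℕ.* y ℕ.* z) ≈ fromℕ x * fromℕ y * fromℕ z
  fromℕ-*³ x y z = trans (fromℕ-* (x ℕ.* y) z) (*-congʳ (fromℕ-* x y))

  normalised⇔D≈0 :
    fromℕ (n₁ n) * a * (fromℕ (n₂ n) * b + fromℕ (n₃ n) * c) ≈ fromℕ (n₄ n) * b * b ⇔ D ≈ 0#
  normalised⇔D≈0 with normalising-factor (2 ℕ.+ m)
  ... | suc k , _ , e₁ , e₂ , e₃ = mk⇔
    (λ L≈R → trans (sym κ[L-R]≈D) (*-≈0ʳ κ (x≈y⇒x∙y⁻¹≈ε L≈R)))
    (λ D≈0 → x∙y⁻¹≈ε⇒x≈y _ _ (*-cancelˡ-≈0 (fromℕ-suc≉0 k) (trans κ[L-R]≈D D≈0)))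
    where
    κ = fromℕ (suc k)
    N₁ = fromℕ (n₁ n)
    N₂ = fromℕ (n₂ n)
    N₃ = fromℕ (n₃ n)
    N₄ = fromℕ (n₄ n)
    N₁N₂κ≈6 : N₁ * N₂ * κ ≈ fromℕ 6
    N₁N₂κ≈6 = trans (sym (fromℕ-*³ (n₁ n) (n₂ n) (suc k))) (reflexive (≡.cong fromℕ e₁))
    N₁N₃κ≈3[ν-2] : N₁ * N₃ * κ ≈ fromℕ 3 * (ν - fromℕ 2)
    N₁N₃κ≈3[ν-2] = trans (sym (fromℕ-*³ (n₁ n) (n₃ n) (suc k)))
      (trans (reflexive (≡.cong fromℕ e₂))
      (trans (fromℕ-* 3 (n ℕ.∸ 2)) (*-congˡ (fromℕ-∸ {n} {2} (s≤s (s≤s z≤n))))))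
    N₄κ≈2[ν-1] : N₄ * κ ≈ fromℕ 2 * (ν - fromℕ 1)
    N₄κ≈2[ν-1] = trans (sym (fromℕ-* (n₄ n) (suc k)))
      (trans (reflexive (≡.cong fromℕ e₃))
      (trans (fromℕ-* 2 (n ℕ.∸ 1)) (*-congˡ (fromℕ-∸ {n} {1} (s≤s z≤n)))))
    κ[L-R]≈D : κ * (N₁ * a * (N₂ * b + N₃ * c) - N₄ * b * b) ≈ D
    κ[L-R]≈D = begin
      κ * (N₁ * a * (N₂ * b + N₃ * c) - N₄ * b * b)
        ≈⟨ solve 8 (λ N₁ N₂ N₃ N₄ κ a b c → κ :* (N₁ :* a :* (N₂ :* b :+ N₃ :* c) :- N₄ :* b :* b)
                  := (N₁ :* N₂ :* κ) :* a :* b :+ (N₁ :* N₃ :* κ) :* a :* c :- (N₄ :* κ) :* b :* b)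
                refl N₁ N₂ N₃ N₄ κ a b c ⟩
      (N₁ * N₂ * κ) * a * b + (N₁ * N₃ * κ) * a * c - (N₄ * κ) * b * b
        ≈⟨ +-cong (+-cong (*-congʳ (*-congʳ N₁N₂κ≈6)) (*-congʳ (*-congʳ N₁N₃κ≈3[ν-2])))
                  (-‿cong (*-congʳ (*-congʳ N₄κ≈2[ν-1]))) ⟩
      fromℕ 6 * a * b + fromℕ 3 * (ν - fromℕ 2) * a * c - fromℕ 2 * (ν - fromℕ 1) * b * b
        ≈⟨ solve 4 (λ a b c ν → con (+ 6) :* a :* b :+ con (+ 3) :* (ν :- con (+ 2)) :* a :* c
                                  :- con (+ 2) :* (ν :- con (+ 1)) :* b :* b
                  := con (+ 3) :* a :* (con (+ 2) :* b :+ (ν :- con (+ 2)) :* c)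
                                  :- con (+ 2) :* (ν :- con (+ 1)) :* b :* b)
                refl a b c ν ⟩
      D ∎

mainTheorem8 : (R : RealField) (n : ℕ) → 3 ≤ n →
    (a b c : RealField.Carrier R) →
    ¬ (RealField._≈_ R a (RealField.0# R) × RealField._≈_ R b (RealField.0# R) × RealField._≈_ R c (RealField.0# R)) →
    Poly.IsException R n a b c ⇔
      (¬ Poly.SameAs136 R a b c ×
       RealField._≈_ R
         (RealField._*_ R (RealField._*_ R (Poly.fromℕ R (n₁ n)) a)
           (RealField._+_ R (RealField._*_ R (Poly.fromℕ R (n₂ n)) b) (RealField._*_ R (Poly.fromℕ R (n₃ n)) c)))
         (RealField._*_ R (RealField._*_ R (Poly.fromℕ R (n₄ n)) b) b))
mainTheorem8 R (suc (suc (suc m))) (s≤s (s≤s (s≤s z≤n))) a b c ¬abc≈0 =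
  (⇔-id _ ×-⇔ ⇔-sym (Normalisation.normalised⇔D≈0 R a b c m)) ⇔-∘ Exception.IsException⇔ R a b c m ¬abc≈0
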